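{- Let $G$ be an infinite $2$-connected graph with a vertex $v$ of infinite degree such that $G$ contains no induced $K_\infty$. Let $\mathcal{V}$ be an infinite independent subset of the neighborhood of $v$, and let $T$ be a $\mathcal{V}$-connecting tree of $G-v$. If $T$ is locally finite, then $G$ contains as an induced subgraph a member of one of the families $\mathscr{F}_\infty$ and $\mathscr{F}_\infty^{\Delta}$.
   Context: $K_\infty$ is the countably infinite complete graph. Subdividing an edge means replacing it by a path (finitely many times). A ray is a one-way infinite path $p_1p_2\dots$. $F_\infty$: an apex vertex adjacent to every vertex of a ray; $\mathscr{F}_\infty$: graphs obtained from $F_\infty$ by subdividing each edge an arbitrary finite (possibly zero) number of times. $F^\Delta_\infty$: apex $a$, vertices $a_1,a_2,\dots$, a ray $p_1p_2\dots$, edges $aa_i$, $a_ip_{2i-1}$, $a_ip_{2i}$ ($i\ge1$); $\mathscr{F}^\Delta_\infty$: graphs obtained from $F^\Delta_\infty$ by subdividing each edge $aa_i$ and each edge $p_{2j}p_{2j+1}$ an arbitrary finite (possibly zero) number of times. $\mathcal{V}$-connecting tree: let $H$ be a connected graph and $\mathcal{V}$ an infinite independent set of its vertices. Choose $v_1\in\mathcal V$, let $P^1$ be the single vertex $v_1$ and $t_1=v_1$. Let $P^2$ be a shortest path in $H$ from $v_1$ to a vertex of $\mathcal V\setminus\{v_1\}$, with $v_2$ its endpoint in $\mathcal V\setminus\{v_1\}$ and $t_2=v_1$. Having defined $v_i,t_i,P^i$ for $i\le k$, give every path $Q$ joining a vertex of $\mathcal V\setminus\{v_1,\dots,v_k\}$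 to a vertex of $P^1\cup\dots\cup P^k$ the grade $(\gamma_1,\gamma_2,\gamma_3)$, where $\gamma_1$ is the length of $Q$, $\gamma_2$ is the minimum $i$ such that the endpoint $u$ of $Q$ lies on $P^i$, and $\gamma_3=\mathrm{dist}_{P^i}(u,t_i)$. Let $P^{k+1}$ be a path of lexicographically minimal grade, $t_{k+1}$ its endpoint on $P^1\cup\dots\cup P^k$ and $v_{k+1}$ its endpoint in $\mathcal V\setminus\{v_1,\dots,v_k\}$. The union $T$ of all $P^k$, rooted at $v_1$, is a $\mathcal V$-connecting tree of $H$. -}

module Defs where

open import Data.Nat using (ℕ; zero; suc; _<_; _≤_; _∸_; _*_)
open import Data.Fin using (Fin; zero; suc; toℕ; fromℕ; inject₁)
open import Data.Product using (Σ; ∃; ∃-syntax; _×_; _,_; proj₁; proj₂)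
open import Data.Sum using (_⊎_; inj₁; inj₂)
open import Data.List using (List)
open import Data.Unit using (⊤)
open import Data.List.Membership.Propositional using (_∈_)
open import Function using (_∘_)
open import Function.Definitions using (Injective)
open import Relation.Nullary using (¬_)
open import Relation.Binary.PropositionalEquality using (_≡_; _≢_)

record Graph : Set₁ where
  field
    V      : Set
    E      : V → V → Set
    E-sym  : ∀ {x y} → E x y → E y x
    E-irr  : ∀ {x} → ¬ E x x
open Graph public

record Path (G : Graph) : Set where
  field
    len : ℕ
    at  : Fin (suc len) → V G
    inj : Injective _≡_ _≡_ at
    adj : (j : Fin len) → E G (at (inject₁ j)) (at (suc j))

  first : V G
  first = at zero

  last : V G
  last = at (fromℕ len)
open Path public

module _ {G : Graph} where

  OnPath : Path G → V G → Set
  OnPath p x = ∃[ j ] at p j ≡ x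

  PathIn : (V G → Set) → Path G → Set
  PathIn S p = ∀ j → S (at p j)

ConnectedIn : (G : Graph) → (V G → Set) → Set
ConnectedIn G S = ∀ x y → S x → S y →
  Σ (Path G) λ p → (first {G} p ≡ x × last {G} p ≡ y × PathIn S p)

TwoConnected : Graph → Set
TwoConnected G =
  (Σ (V G) λ x → Σ (V G) λ y → Σ (V G) λ z → (x ≢ y × y ≢ z × x ≢ z))
  × ConnectedIn G (λ _ → ⊤)
  × (∀ x → ConnectedIn G (λ y → y ≢ x))

InfiniteGraph : Graph → Set
InfiniteGraph G = Σ (ℕ → V G) λ f → Injective _≡_ _≡_ f

InfiniteDegree : (G : Graph) → V G → Set
InfiniteDegree G v = Σ (ℕ → V G) λ f → Injective _≡_ _≡_ f × (∀ i → E G v (f i))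

-- G contains K_∞ as an induced subgraph (= an infinite clique)
HasInducedKInf : Graph → Set
HasInducedKInf G =
  Σ (ℕ → V G) λ f → Injective _≡_ _≡_ f × (∀ i j → i ≢ j → E G (f i) (f j))

InfIndepNbhd : (G : Graph) (v : V G) (𝒱 : V G → Set) → Set
InfIndepNbhd G v 𝒱 =
  (∀ x → 𝒱 x → E G v x)
  × (∀ x y → 𝒱 x → 𝒱 y → ¬ E G x y)
  × (Σ (ℕ → V G) λ f → Injective _≡_ _≡_ f × (∀ i → 𝒱 (f i)))

-- 𝒱-connecting trees of H = G - v.
-- Paths are indexed from 0: P 0 = P^1, P k = P^(k+1).
-- P k starts at v_(k+1) ∈ 𝒱 and ends at t_(k+1) (for P 0 both are v_1).

_≤lex_ : ℕ × ℕ × ℕ → ℕ × ℕ × ℕ → Set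
(a₁ , a₂ , a₃) ≤lex (b₁ , b₂ , b₃) =
  a₁ < b₁ ⊎ (a₁ ≡ b₁ × (a₂ < b₂ ⊎ (a₂ ≡ b₂ × a₃ ≤ b₃)))

module _ {G : Graph} (v : V G) (𝒱 : V G → Set) (P : ℕ → Path G) where

  -- x is one of v_1..v_k (the starting vertices of P 0 .. P (k-1))
  Used : ℕ → V G → Set
  Used k x = ∃[ i ] (i < k × first {G} (P i) ≡ x)

  InTreeUpTo : ℕ → V G → Set
  InTreeUpTo k x = ∃[ i ] (i < k × OnPath (P i) x)

  -- u lies on P^1 ∪ ... ∪ P^k, i is the least index with u on P i,
  -- and d = dist_{P i}(u, t_i)  (t_i being the last vertex of P i)
  GradePos : ℕ → V G → ℕ → ℕ → Set
  GradePos k u i d =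
    i < k × (∀ i' → i' < i → ¬ OnPath (P i') u)
    × (∃[ j ] (at (P i) j ≡ u × d ≡ len (P i) ∸ toℕ j))

  Candidate : ℕ → Path G → Set
  Candidate k Q =
    PathIn (λ x → x ≢ v) Q
    × 𝒱 (first {G} Q) × ¬ Used k (first {G} Q)
    × InTreeUpTo k (last {G} Q)

record VConnTree (G : Graph) (v : V G) (𝒱 : V G → Set) : Set where
  field
    P      : ℕ → Path G
    P-inH  : ∀ k j → at (P k) j ≢ v
    base   : len (P 0) ≡ 0 × 𝒱 (first {G} (P 0))
    step   : ∀ k → 1 ≤ k →
      Candidate v 𝒱 P k (P k)
      × (∃[ i ] ∃[ d ] (GradePos v 𝒱 P k (last {G} (P k)) i d
          × (∀ Q i' d' → Candidate v 𝒱 P k Q → GradePos v 𝒱 P k (last {G} Q) i' d'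
               → (len (P k) , i , d) ≤lex (len Q , i' , d'))))

  TV : V G → Set
  TV x = ∃[ k ] OnPath (P k) x

  TE : V G → V G → Set
  TE x y = ∃[ k ] ∃[ j ]
    ((at (P k) (inject₁ j) ≡ x × at (P k) (suc j) ≡ y)
     ⊎ (at (P k) (inject₁ j) ≡ y × at (P k) (suc j) ≡ x))

  LocallyFinite : Set
  LocallyFinite = ∀ x → TV x → Σ (List (V G)) λ L → (∀ y → TE x y → y ∈ L)

record BaseGraph : Set₁ where
  field
    W    : Set
    Ed   : Set
    ends : Ed → W × W
open BaseGraph public

-- vertices of the subdivision: original vertices, plus σ e new
-- interior vertices on each edge e
SubV : (B : BaseGraph) → (Ed B → ℕ) → Set
SubV B σ = W B ⊎ Σ (Ed B) (λ e → Fin (σ e))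

-- the m-th vertex along a path s, f 0, ..., f (n-1), t
walk : {A : Set} (n : ℕ) → A → A → (Fin n → A) → ℕ → A
walk n       s t f zero    = s
walk zero    s t f (suc m) = t
walk (suc n) s t f (suc m) = walk n (f zero) t (f ∘ suc) m

module _ (B : BaseGraph) (σ : Ed B → ℕ) where

  edgeWalk : Ed B → ℕ → SubV B σ
  edgeWalk e = walk (σ e) (inj₁ (proj₁ (ends B e))) (inj₁ (proj₂ (ends B e)))
                          (λ j → inj₂ (e , j))

  SubAdj : SubV B σ → SubV B σ → Set
  SubAdj x y = ∃[ e ] ∃[ m ] (m ≤ σ e ×
    ((edgeWalk e m ≡ x × edgeWalk e (suc m) ≡ y)
     ⊎ (edgeWalk e m ≡ y × edgeWalk e (suc m) ≡ x)))

InducedCopy : (G : Graph) (B : BaseGraph) (σ : Ed B → ℕ) → Set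
InducedCopy G B σ = Σ (SubV B σ → V G) λ f →
  Injective _≡_ _≡_ f
  × (∀ x y → SubAdj B σ x y → E G (f x) (f y))
  × (∀ x y → E G (f x) (f y) → SubAdj B σ x y)

data F∞V : Set where
  apex : F∞V
  p    : ℕ → F∞V

data F∞E : Set where
  spoke : ℕ → F∞E
  ray   : ℕ → F∞E

F∞ : BaseGraph
F∞ = record { W = F∞V ; Ed = F∞E ; ends = e }
  where
    e : F∞E → F∞V × F∞V
    e (spoke i) = apex , p i
    e (ray i)   = p i , p (suc i)


-- F^Δ_∞ (0-indexed): apex, a n (= a_(n+1)), q m (= p_(m+1));
-- edges apex—a n, a n — q (2n), a n — q (2n+1), q m — q (m+1).

data FΔV : Set where
  apexΔ : FΔV
  a     : ℕ → FΔV
  q     : ℕ → FΔV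

data FΔE : Set where
  apexA : ℕ → FΔE
  aQ₁   : ℕ → FΔE
  aQ₂   : ℕ → FΔE
  rayΔ  : ℕ → FΔE

FΔ : BaseGraph
FΔ = record { W = FΔV ; Ed = FΔE ; ends = e }
  where
    e : FΔE → FΔV × FΔV
    e (apexA n) = apexΔ , a n
    e (aQ₁ n)   = a n , q (2 * n)
    e (aQ₂ n)   = a n , q (suc (2 * n))
    e (rayΔ m)  = q m , q (suc m)

-- members of 𝓕^Δ_∞: only the edges a a_i and p_(2j) p_(2j+1) (j ≥ 1) may be
-- subdivided; p_(2j) p_(2j+1) is rayΔ (2j-1), so rayΔ (2j) is never subdivided
AllowedΔ : (FΔE → ℕ) → Set
AllowedΔ σ = (∀ n → σ (aQ₁ n) ≡ 0) × (∀ n → σ (aQ₂ n) ≡ 0)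
           × (∀ j → σ (rayΔ (2 * j)) ≡ 0)

-- The minimality of the grades makes the connecting tree rigid: a path P^k meets the earlier tree
-- only in its last vertex, has no chords, and its only other edges to the earlier tree leave
-- from its penultimate vertex towards vertices of grade at least that of its attachment point.
-- As T is infinite and locally finite, König's lemma gives an infinite branch of paths, each
-- attached to the previous one. Their union is a comb: a spine ray, obtained by walking down
-- each path to the attachment point of the next, with legs hanging down to the vertices of 𝒱,
-- all adjacent to v. If v sees infinitely many spine vertices, v and the spine form an F_∞.
-- Otherwise, far out, v sees only legs; on each leg the last v-neighbour below the attachment
-- point starts a subdivided spoke, which reaches the spine in a single vertex or, when the next
-- leg's top sees two consecutive leg vertices, in a triangle. Infinitely many triangles give a
-- member of 𝓕^Δ_∞, otherwise sparse triangle-free legs give a member of 𝓕_∞.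
module Submission where

open import Defs
open import Level using (0ℓ)
open import Axiom.ExcludedMiddle using (ExcludedMiddle)
open import Data.Nat
open import Data.Nat.Properties
open import Data.Nat.ListAction using (sum)
open import Data.Nat.Induction using (<-rec)
open import Data.Fin using (Fin; zero; suc; toℕ; fromℕ; fromℕ<)
open import Data.Fin.Properties
  using (toℕ-fromℕ<; toℕ-injective; toℕ<n; toℕ-inject₁; toℕ-fromℕ; toℕ≤pred[n])
open import Data.List using (List; _∷_; map)
open import Data.List.Relation.Unary.Any using (here; there)
open import Data.List.Membership.Propositional using (_∈_)
open import Data.Product using (Σ; ∃; _×_; _,_; proj₁; proj₂)
open import Data.Sum using (_⊎_; inj₁; inj₂)
open import Data.Unit using (⊤; tt)
open import Data.Empty using (⊥; ⊥-elim)
open import Function using (_∘_)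
open import Relation.Nullary using (¬_; yes; no; Dec)
open import Relation.Unary using (Decidable)
open import Relation.Binary using (tri<; tri≈; tri>)
open import Relation.Binary.PropositionalEquality

m<o∸n⇒n+m<o : ∀ {m n o} → m < o ∸ n → n + m < o
m<o∸n⇒n+m<o {n = zero} h = h
m<o∸n⇒n+m<o {n = suc n} {suc o} h = s≤s (m<o∸n⇒n+m<o {n = n} h)

m<1+o∸n⇒n+m≤o : ∀ {m n o} → m < suc o ∸ n → n + m ≤ o
m<1+o∸n⇒n+m≤o {n = n} h = ≤-pred (m<o∸n⇒n+m<o {n = n} h)

n≤o⇒0<1+o∸n : ∀ {n o} → n ≤ o → 0 < suc o ∸ n
n≤o⇒0<1+o∸n h = subst (0 <_) (sym (+-∸-assoc 1 h)) (s≤s z≤n)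

1+m≡1+o∸n⇒n+m≡o : ∀ {m n o} → n ≤ o → suc m ≡ suc o ∸ n → n + m ≡ o
1+m≡1+o∸n⇒n+m≡o {m} {n} {o} h eq =
  suc-injective (trans (sym (+-suc n m)) (trans (cong (n +_) eq) (m+[n∸m]≡n (≤-trans h (n≤1+n o)))))

n+m≡o⇒1+m≡1+o∸n : ∀ {m n o} → n + m ≡ o → suc m ≡ suc o ∸ n
n+m≡o⇒1+m≡1+o∸n {m} {n} refl = sym (trans (cong (_∸ n) (sym (+-suc n m))) (m+n∸m≡n n (suc m)))

suc-pred-≥1 : ∀ {n} → 1 ≤ n → suc (pred n) ≡ n
suc-pred-≥1 {suc n} _ = refl

∈⇒≤sum : ∀ {A : Set} (f : A → ℕ) {y : A} {xs : List A} → y ∈ xs → f y ≤ sum (map f xs)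
∈⇒≤sum f (here refl) = m≤m+n _ _
∈⇒≤sum f {xs = x ∷ xs} (there h) = ≤-trans (∈⇒≤sum f h) (m≤n+m _ (f x))

sumUpTo : ℕ → (ℕ → ℕ) → ℕ
sumUpTo zero g = g 0
sumUpTo (suc n) g = g (suc n) + sumUpTo n g

≤sumUpTo : ∀ g {x n} → x ≤ n → g x ≤ sumUpTo n g
≤sumUpTo g {zero} {zero} _ = ≤-refl
≤sumUpTo g {x} {suc n} h with m≤n⇒m<n∨m≡n h
... | inj₁ lt = ≤-trans (≤sumUpTo g (≤-pred lt)) (m≤n+m _ (g (suc n)))
... | inj₂ refl = m≤m+n _ _

walk-inner : {A : Set} (n : ℕ) (s t : A) (F : Fin n → A) (j : Fin n) →
  walk n s t F (suc (toℕ j)) ≡ F j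
walk-inner (suc n) s t F zero = refl
walk-inner (suc n) s t F (suc j) = walk-inner n (F zero) t (F ∘ suc) j

walk-inner-< : {A : Set} (n : ℕ) (s t : A) (F : Fin n → A) (k : ℕ) (k<n : k < n) →
  walk n s t F (suc k) ≡ F (fromℕ< k<n)
walk-inner-< n s t F k k<n =
  trans (cong (walk n s t F ∘ suc) (sym (toℕ-fromℕ< k<n))) (walk-inner n s t F (fromℕ< k<n))

walk-last : {A : Set} (n : ℕ) (s t : A) (F : Fin n → A) → walk n s t F (suc n) ≡ t
walk-last zero s t F = refl
walk-last (suc n) s t F = walk-last n (F zero) t (F ∘ suc)

module StrictlyIncreasing (e : ℕ → ℕ) (e-inc : ∀ n → e n < e (suc n)) where

  mono-< : ∀ {n n'} → n < n' → e n < e n'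
  mono-< {n} {suc n'} (s≤s n≤n') with m≤n⇒m<n∨m≡n n≤n'
  ... | inj₁ lt = <-trans (mono-< lt) (e-inc n')
  ... | inj₂ refl = e-inc n

  mono-≤ : ∀ {n n'} → n ≤ n' → e n ≤ e n'
  mono-≤ h with m≤n⇒m<n∨m≡n h
  ... | inj₁ lt = <⇒≤ (mono-< lt)
  ... | inj₂ refl = ≤-refl

  injective : ∀ {n n'} → e n ≡ e n' → n ≡ n'
  injective {n} {n'} eq with <-cmp n n'
  ... | tri< u _ _ = ⊥-elim (<⇒≢ (mono-< u) eq)
  ... | tri≈ _ b _ = b
  ... | tri> _ _ c = ⊥-elim (<⇒≢ (mono-< c) (sym eq))

  interval-unique : ∀ {n n' i} → e n ≤ i → i < e (suc n) → e n' ≤ i → i < e (suc n') → n ≡ n'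
  interval-unique {n} {n'} u b c d with <-cmp n n'
  ... | tri< lt _ _ = ⊥-elim (<⇒≱ b (≤-trans (mono-≤ lt) c))
  ... | tri≈ _ eq _ = eq
  ... | tri> _ _ gt = ⊥-elim (<⇒≱ d (≤-trans (mono-≤ gt) u))

  interval-locate : ∀ i → e 0 ≤ i → Σ ℕ λ n → e n ≤ i × i < e (suc n)
  interval-locate zero h = 0 , h , ≤-trans (s≤s z≤n) (e-inc 0)
  interval-locate (suc i) h with e 0 ≤? i
  ... | no ¬p = 0 , h , ≤-trans (s≤s (≤-reflexive (≤-antisym (≰⇒> ¬p) h))) (e-inc 0)
  ... | yes pp with interval-locate i pp
  ... | n , u , b with m≤n⇒m<n∨m≡n b
  ... | inj₁ lt = n , m≤n⇒m≤1+n u , lt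
  ... | inj₂ eq = suc n , ≤-reflexive (sym eq) , subst (_< e (suc (suc n))) (sym eq) (e-inc (suc n))

module Search (P : ℕ → Set) (P? : Decidable P) where

  Least : ℕ → Set
  Least n = P n × (∀ k → k < n → ¬ P k)

  least-from : ∀ fuel k → P (k + fuel) → (∀ k' → k' < k → ¬ P k') → ∃ Least
  least-from fuel k pk h with P? k
  ... | yes pk' = k , pk' , h
  least-from zero k pk h | no ¬pk = ⊥-elim (¬pk (subst P (+-identityʳ k) pk))
  least-from (suc fuel) k pk h | no ¬pk = least-from fuel (suc k) (subst P (+-suc k fuel) pk) h'
    where h' : ∀ k' → k' < suc k → ¬ P k'
          h' k' (s≤s k'≤k) with m≤n⇒m<n∨m≡n k'≤k
          ... | inj₁ lt = h k' lt
          ... | inj₂ refl = ¬pk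

  least : ∀ n → P n → ∃ Least
  least n pn = least-from n 0 pn (λ _ ())

  least≤ : ∀ n (pn : P n) → proj₁ (least n pn) ≤ n
  least≤ n pn with least n pn
  ... | k , pk , h with <-cmp k n
  ... | tri< lt _ _ = <⇒≤ lt
  ... | tri≈ _ eq _ = ≤-reflexive eq
  ... | tri> _ _ gt = ⊥-elim (h n gt pn)

  greatest≤ : ∀ B → P 0 → Σ ℕ λ k → k ≤ B × P k × (∀ k' → k < k' → k' ≤ B → ¬ P k')
  greatest≤ zero p0 = 0 , z≤n , p0 , λ { k' lt z≤n → ⊥-elim (<-irrefl refl lt) }
  greatest≤ (suc B) p0 with P? (suc B)
  ... | yes pB = suc B , ≤-refl , pB , λ k' lt le → ⊥-elim (<-irrefl refl (<-≤-trans lt le))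
  ... | no ¬pB with greatest≤ B p0
  ... | k , le , pk , h = k , m≤n⇒m≤1+n le , pk , h'
    where h' : ∀ k' → k < k' → k' ≤ suc B → ¬ P k'
          h' k' lt le' with m≤n⇒m<n∨m≡n le'
          ... | inj₁ lt' = h k' lt (≤-pred lt')
          ... | inj₂ refl = ¬pB

-- Induced subdivisions from labellings

-- Valid singles out the labels that occur, so an embedding of the label graph need only be
-- injective and adjacency-reflecting on those.
record LabelledSubdivision (B : BaseGraph) (σ : Ed B → ℕ) : Set₁ where
  field
    Label       : Set
    label       : SubV B σ → Label
    label-inj   : ∀ x y → label x ≡ label y → x ≡ y
    Valid       : Label → Set
    label-valid : ∀ x → Valid (label x)
    _∼_         : Label → Label → Set
    walk-∼      : ∀ e k → k ≤ σ e → label (edgeWalk B σ e k) ∼ label (edgeWalk B σ e (suc k))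
    ∼-walk      : ∀ {α β} → α ∼ β → Σ (Ed B) λ e → Σ ℕ λ k →
                  k ≤ σ e × label (edgeWalk B σ e k) ≡ α × label (edgeWalk B σ e (suc k)) ≡ β

  induced-copy : (G : Graph) (g : Label → V G) →
    (∀ α β → Valid α → Valid β → g α ≡ g β → α ≡ β) →
    (∀ α β → α ∼ β → E G (g α) (g β)) →
    (∀ α β → Valid α → Valid β → E G (g α) (g β) → α ∼ β ⊎ β ∼ α) →
    InducedCopy G B σ
  induced-copy G g g-inj g-adj g-reflect = g ∘ label , injective , preserve , reflect
    where
      injective : ∀ {x y} → g (label x) ≡ g (label y) → x ≡ y
      injective {x} {y} eq = label-inj x y (g-inj _ _ (label-valid x) (label-valid y) eq)
      preserve : ∀ x y → SubAdj B σ x y → E G (g (label x)) (g (label y))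
      preserve x y (e , k , h , inj₁ (refl , refl)) = g-adj _ _ (walk-∼ e k h)
      preserve x y (e , k , h , inj₂ (refl , refl)) = E-sym G (g-adj _ _ (walk-∼ e k h))
      reflect : ∀ x y → E G (g (label x)) (g (label y)) → SubAdj B σ x y
      reflect x y ed with g-reflect _ _ (label-valid x) (label-valid y) ed
      ... | inj₁ u with ∼-walk u
      ... | e , k , h , p₁ , p₂ = e , k , h , inj₁ (label-inj _ _ p₁ , label-inj _ _ p₂)
      reflect x y ed | inj₂ u with ∼-walk u
      ... | e , k , h , p₁ , p₂ = e , k , h , inj₂ (label-inj _ _ p₁ , label-inj _ _ p₂)

-- Vertex p n of F∞ is labelled by its position e n on the subdivided ray, and the spoke to
-- p n is subdivided m n times.
module F∞Labels (e : ℕ → ℕ) (e-inc : ∀ n → e n < e (suc n)) (m : ℕ → ℕ) where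
  open StrictlyIncreasing e e-inc

  σ : F∞E → ℕ
  σ (spoke n) = m n
  σ (ray n) = e (suc n) ∸ suc (e n)

  data Label : Set where
    apexL  : Label
    rayL   : ℕ → Label
    spokeL : ℕ → ℕ → Label

  Valid : Label → Set
  Valid apexL = ⊤
  Valid (rayL i) = e 0 ≤ i
  Valid (spokeL n j) = j < m n

  data _∼_ : Label → Label → Set where
    apex-spoke  : ∀ n → 0 < m n → apexL ∼ spokeL n 0
    apex-ray    : ∀ n → m n ≡ 0 → apexL ∼ rayL (e n)
    spoke-spoke : ∀ n j → suc j < m n → spokeL n j ∼ spokeL n (suc j)
    spoke-ray   : ∀ n j → suc j ≡ m n → spokeL n j ∼ rayL (e n)
    ray-ray     : ∀ i → e 0 ≤ i → rayL i ∼ rayL (suc i)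

  label : SubV F∞ σ → Label
  label (inj₁ apex) = apexL
  label (inj₁ (p i)) = rayL (e i)
  label (inj₂ (spoke n , j)) = spokeL n (toℕ j)
  label (inj₂ (ray n , j)) = rayL (suc (e n + toℕ j))

  label-valid : ∀ x → Valid (label x)
  label-valid (inj₁ apex) = tt
  label-valid (inj₁ (p i)) = mono-≤ z≤n
  label-valid (inj₂ (spoke n , j)) = toℕ<n j
  label-valid (inj₂ (ray n , j)) = ≤-trans (mono-≤ z≤n) (≤-trans (m≤m+n (e n) (toℕ j)) (n≤1+n _))

  ray-interval : ∀ n (j : Fin (σ (ray n))) → e n ≤ suc (e n + toℕ j) × suc (e n + toℕ j) < e (suc n)
  ray-interval n j = ≤-trans (m≤m+n (e n) (toℕ j)) (n≤1+n _) , m<o∸n⇒n+m<o {n = suc (e n)} (toℕ<n j)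

  rayL-injective : ∀ {i i'} → rayL i ≡ rayL i' → i ≡ i'
  rayL-injective refl = refl

  spokeL-injective : ∀ {n j n' j'} → spokeL n j ≡ spokeL n' j' → n ≡ n' × j ≡ j'
  spokeL-injective refl = refl , refl

  label-inj : ∀ x y → label x ≡ label y → x ≡ y
  label-inj (inj₁ apex) (inj₁ apex) eq = refl
  label-inj (inj₁ apex) (inj₁ (p i)) ()
  label-inj (inj₁ apex) (inj₂ (spoke n , j)) ()
  label-inj (inj₁ apex) (inj₂ (ray n , j)) ()
  label-inj (inj₁ (p i)) (inj₁ apex) ()
  label-inj (inj₁ (p i)) (inj₁ (p i')) eq = cong (inj₁ ∘ p) (injective (rayL-injective eq))
  label-inj (inj₁ (p i)) (inj₂ (spoke n , j)) ()
  label-inj (inj₁ (p i)) (inj₂ (ray n , j)) eq with ray-interval n j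
  ... | u , b with interval-unique {i} {n} ≤-refl (e-inc i) (subst (e n ≤_) (sym (rayL-injective eq)) u)
                                               (subst (_< e (suc n)) (sym (rayL-injective eq)) b)
  ... | refl = ⊥-elim (<⇒≢ (s≤s (m≤m+n (e n) (toℕ j))) (rayL-injective eq))
  label-inj (inj₂ (spoke n , j)) (inj₁ apex) ()
  label-inj (inj₂ (spoke n , j)) (inj₁ (p i)) ()
  label-inj (inj₂ (spoke n , j)) (inj₂ (spoke n' , j')) eq with spokeL-injective eq
  ... | refl , j≡j' = cong (λ z → inj₂ (spoke n , z)) (toℕ-injective j≡j')
  label-inj (inj₂ (spoke n , j)) (inj₂ (ray n' , j')) ()
  label-inj (inj₂ (ray n , j)) (inj₁ apex) ()
  label-inj (inj₂ (ray n , j)) (inj₁ (p i)) eq = sym (label-inj (inj₁ (p i)) (inj₂ (ray n , j)) (sym eq))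
  label-inj (inj₂ (ray n , j)) (inj₂ (spoke n' , j')) ()
  label-inj (inj₂ (ray n , j)) (inj₂ (ray n' , j')) eq with ray-interval n j | ray-interval n' j'
  ... | u , b | u' , b' with interval-unique u b (subst (e n' ≤_) (sym (rayL-injective eq)) u')
                                               (subst (_< e (suc n')) (sym (rayL-injective eq)) b')
  ... | refl = cong (λ z → inj₂ (ray n , z)) (toℕ-injective (+-cancelˡ-≡ (e n) _ _ (suc-injective (rayL-injective eq))))

  labelAt : F∞E → ℕ → Label
  labelAt edge k = label (edgeWalk F∞ σ edge k)

  labelAt-spoke-inner : ∀ n k → k < m n → labelAt (spoke n) (suc k) ≡ spokeL n k
  labelAt-spoke-inner n k lt =
    trans (cong label (walk-inner-< (m n) _ _ _ k lt)) (cong (spokeL n) (toℕ-fromℕ< lt))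

  labelAt-spoke-last : ∀ n k → k ≡ m n → labelAt (spoke n) (suc k) ≡ rayL (e n)
  labelAt-spoke-last n k refl = cong label (walk-last (m n) _ _ _)

  labelAt-ray : ∀ n k → k ≤ suc (σ (ray n)) → labelAt (ray n) k ≡ rayL (e n + k)
  labelAt-ray n zero h = cong rayL (sym (+-identityʳ (e n)))
  labelAt-ray n (suc k) (s≤s h) with m≤n⇒m<n∨m≡n h
  ... | inj₁ lt = trans (cong label (walk-inner-< (σ (ray n)) _ _ _ k lt))
                        (cong rayL (trans (cong (λ z → suc (e n + z)) (toℕ-fromℕ< lt)) (sym (+-suc (e n) k))))
  ... | inj₂ refl = trans (cong label (walk-last (σ (ray n)) _ _ _))
                          (cong rayL (sym (trans (+-suc (e n) _) (m+[n∸m]≡n (e-inc n)))))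

  walk-∼ : ∀ edge k → k ≤ σ edge → labelAt edge k ∼ labelAt edge (suc k)
  walk-∼ (spoke n) zero _ = first-step (m n) refl
    where
      first-step : ∀ z → m n ≡ z → labelAt (spoke n) 0 ∼ labelAt (spoke n) 1
      first-step zero eq = subst (apexL ∼_) (sym (labelAt-spoke-last n 0 (sym eq))) (apex-ray n eq)
      first-step (suc z) eq = subst (apexL ∼_) (sym (labelAt-spoke-inner n 0 0<m)) (apex-spoke n 0<m)
        where 0<m : 0 < m n
              0<m = subst (0 <_) (sym eq) (s≤s z≤n)
  walk-∼ (spoke n) (suc k) h with m≤n⇒m<n∨m≡n h
  ... | inj₁ lt = subst₂ _∼_ (sym (labelAt-spoke-inner n k (<-trans (n<1+n k) lt)))
                             (sym (labelAt-spoke-inner n (suc k) lt)) (spoke-spoke n k lt)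
  ... | inj₂ eq = subst₂ _∼_ (sym (labelAt-spoke-inner n k (≤-reflexive eq)))
                             (sym (labelAt-spoke-last n (suc k) eq)) (spoke-ray n k eq)
  walk-∼ (ray n) k h = subst₂ _∼_ (sym (labelAt-ray n k (m≤n⇒m≤1+n h)))
     (sym (trans (labelAt-ray n (suc k) (s≤s h)) (cong rayL (+-suc (e n) k))))
     (ray-ray (e n + k) (≤-trans (mono-≤ z≤n) (m≤m+n (e n) k)))

  ∼-walk : ∀ {α β} → α ∼ β → Σ F∞E λ edge → Σ ℕ λ k →
           k ≤ σ edge × labelAt edge k ≡ α × labelAt edge (suc k) ≡ β
  ∼-walk (apex-spoke n x) = spoke n , 0 , z≤n , refl , labelAt-spoke-inner n 0 x
  ∼-walk (apex-ray n x) = spoke n , 0 , z≤n , refl , labelAt-spoke-last n 0 (sym x)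
  ∼-walk (spoke-spoke n j x) =
    spoke n , suc j , <⇒≤ x , labelAt-spoke-inner n j (<-trans (n<1+n j) x) , labelAt-spoke-inner n (suc j) x
  ∼-walk (spoke-ray n j x) =
    spoke n , suc j , ≤-reflexive x , labelAt-spoke-inner n j (≤-reflexive x) , labelAt-spoke-last n (suc j) x
  ∼-walk (ray-ray i x) with interval-locate i x
  ... | n , u , b =
    ray n , i ∸ e n , k≤ , trans (labelAt-ray n (i ∸ e n) (m≤n⇒m≤1+n k≤)) (cong rayL (m+[n∸m]≡n u)) ,
    trans (labelAt-ray n (suc (i ∸ e n)) (s≤s k≤)) (cong rayL (trans (+-suc (e n) _) (cong suc (m+[n∸m]≡n u))))
    where k≤ : i ∸ e n ≤ σ (ray n)
          k≤ = ≤-trans (suc[m]≤n⇒m≤pred[n] (∸-monoˡ-< b u)) (≤-reflexive (pred[m∸n]≡m∸[1+n] (e (suc n)) (e n)))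

  labelling : LabelledSubdivision F∞ σ
  labelling = record
    { Label = Label ; label = label ; label-inj = label-inj ; Valid = Valid ; label-valid = label-valid
    ; _∼_ = _∼_ ; walk-∼ = walk-∼ ; ∼-walk = ∼-walk }

  open LabelledSubdivision labelling public using (induced-copy)

data EvenOdd : ℕ → Set where
  even : ∀ n → EvenOdd (2 * n)
  odd  : ∀ n → EvenOdd (suc (2 * n))

2*suc : ∀ n → 2 * suc n ≡ suc (suc (2 * n))
2*suc n = cong suc (+-suc n (n + 0))

even-or-odd : ∀ k → EvenOdd k
even-or-odd zero = even 0
even-or-odd (suc k) with even-or-odd k
... | even n = odd n
... | odd n = subst EvenOdd (2*suc n) (even (suc n))

lsb : ℕ → ℕ
lsb zero = 0
lsb (suc zero) = 1
lsb (suc (suc k)) = lsb k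

⌊2*n/2⌋≡n : ∀ n → ⌊ 2 * n /2⌋ ≡ n
⌊2*n/2⌋≡n zero = refl
⌊2*n/2⌋≡n (suc n) = trans (cong ⌊_/2⌋ (2*suc n)) (cong suc (⌊2*n/2⌋≡n n))

⌊1+2*n/2⌋≡n : ∀ n → ⌊ suc (2 * n) /2⌋ ≡ n
⌊1+2*n/2⌋≡n zero = refl
⌊1+2*n/2⌋≡n (suc n) = trans (cong (⌊_/2⌋ ∘ suc) (2*suc n)) (cong suc (⌊1+2*n/2⌋≡n n))

lsb-even : ∀ n → lsb (2 * n) ≡ 0
lsb-even zero = refl
lsb-even (suc n) = trans (cong lsb (2*suc n)) (lsb-even n)

lsb-odd : ∀ n → lsb (suc (2 * n)) ≡ 1
lsb-odd zero = refl
lsb-odd (suc n) = trans (cong (lsb ∘ suc) (2*suc n)) (lsb-odd n)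

-- The branch vertices q (2 n) and q (2 n + 1) of FΔ sit at the adjacent ray positions e n and
-- e n + 1, the vertex a n is labelled triL n, and the spoke to a n is subdivided m n times.
module FΔLabels (e : ℕ → ℕ) (e-gap : ∀ n → suc (e n) < e (suc n)) (m : ℕ → ℕ) where

  pos : ℕ → ℕ
  pos k = e ⌊ k /2⌋ + lsb k

  pos-even : ∀ n → pos (2 * n) ≡ e n
  pos-even n rewrite ⌊2*n/2⌋≡n n | lsb-even n = +-identityʳ (e n)

  pos-odd : ∀ n → pos (suc (2 * n)) ≡ suc (e n)
  pos-odd n rewrite ⌊1+2*n/2⌋≡n n | lsb-odd n = +-comm (e n) 1

  pos-inc : ∀ k → pos k < pos (suc k)
  pos-inc k with even-or-odd k
  ... | even n = subst₂ _<_ (sym (pos-even n)) (sym (pos-odd n)) ≤-refl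
  ... | odd n = subst₂ _<_ (sym (pos-odd n)) (trans (sym (pos-even (suc n))) (cong pos (2*suc n))) (e-gap n)

  open StrictlyIncreasing pos pos-inc

  σ : FΔE → ℕ
  σ (apexA n) = m n
  σ (aQ₁ n) = 0
  σ (aQ₂ n) = 0
  σ (rayΔ k) = pos (suc k) ∸ suc (pos k)

  allowed : AllowedΔ σ
  allowed = (λ _ → refl) , (λ _ → refl) ,
            λ j → trans (cong₂ (λ x y → x ∸ suc y) (pos-odd j) (pos-even j)) (n∸n≡0 (e j))

  data Label : Set where
    apexL  : Label
    rayL   : ℕ → Label
    triL   : ℕ → Label
    spokeL : ℕ → ℕ → Label

  Valid : Label → Set
  Valid apexL = ⊤
  Valid (rayL i) = pos 0 ≤ i
  Valid (triL n) = ⊤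
  Valid (spokeL n j) = j < m n

  data _∼_ : Label → Label → Set where
    apex-spoke  : ∀ n → 0 < m n → apexL ∼ spokeL n 0
    apex-tri    : ∀ n → m n ≡ 0 → apexL ∼ triL n
    spoke-spoke : ∀ n j → suc j < m n → spokeL n j ∼ spokeL n (suc j)
    spoke-tri   : ∀ n j → suc j ≡ m n → spokeL n j ∼ triL n
    tri-ray₁    : ∀ n → triL n ∼ rayL (e n)
    tri-ray₂    : ∀ n → triL n ∼ rayL (suc (e n))
    ray-ray     : ∀ i → pos 0 ≤ i → rayL i ∼ rayL (suc i)

  label : SubV FΔ σ → Label
  label (inj₁ apexΔ) = apexL
  label (inj₁ (a n)) = triL n
  label (inj₁ (q k)) = rayL (pos k)
  label (inj₂ (apexA n , j)) = spokeL n (toℕ j)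
  label (inj₂ (rayΔ k , j)) = rayL (suc (pos k + toℕ j))

  label-valid : ∀ x → Valid (label x)
  label-valid (inj₁ apexΔ) = tt
  label-valid (inj₁ (a n)) = tt
  label-valid (inj₁ (q k)) = mono-≤ z≤n
  label-valid (inj₂ (apexA n , j)) = toℕ<n j
  label-valid (inj₂ (rayΔ k , j)) = ≤-trans (mono-≤ z≤n) (≤-trans (m≤m+n (pos k) (toℕ j)) (n≤1+n _))

  ray-interval : ∀ k (j : Fin (σ (rayΔ k))) → pos k ≤ suc (pos k + toℕ j) × suc (pos k + toℕ j) < pos (suc k)
  ray-interval k j = ≤-trans (m≤m+n (pos k) (toℕ j)) (n≤1+n _) , m<o∸n⇒n+m<o {n = suc (pos k)} (toℕ<n j)

  rayL-injective : ∀ {i i'} → rayL i ≡ rayL i' → i ≡ i'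
  rayL-injective refl = refl

  triL-injective : ∀ {n n'} → triL n ≡ triL n' → n ≡ n'
  triL-injective refl = refl

  spokeL-injective : ∀ {n j n' j'} → spokeL n j ≡ spokeL n' j' → n ≡ n' × j ≡ j'
  spokeL-injective refl = refl , refl

  label-inj : ∀ x y → label x ≡ label y → x ≡ y
  label-inj (inj₁ apexΔ) (inj₁ apexΔ) eq = refl
  label-inj (inj₁ apexΔ) (inj₁ (a n)) ()
  label-inj (inj₁ apexΔ) (inj₁ (q k)) ()
  label-inj (inj₁ apexΔ) (inj₂ (apexA n , j)) ()
  label-inj (inj₁ apexΔ) (inj₂ (rayΔ k , j)) ()
  label-inj (inj₁ (a n)) (inj₁ apexΔ) ()
  label-inj (inj₁ (a n)) (inj₁ (a n')) eq = cong (inj₁ ∘ a) (triL-injective eq)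
  label-inj (inj₁ (a n)) (inj₁ (q k)) ()
  label-inj (inj₁ (a n)) (inj₂ (apexA n' , j)) ()
  label-inj (inj₁ (a n)) (inj₂ (rayΔ k , j)) ()
  label-inj (inj₁ (q k)) (inj₁ apexΔ) ()
  label-inj (inj₁ (q k)) (inj₁ (a n)) ()
  label-inj (inj₁ (q k)) (inj₁ (q k')) eq = cong (inj₁ ∘ q) (injective (rayL-injective eq))
  label-inj (inj₁ (q k)) (inj₂ (apexA n , j)) ()
  label-inj (inj₁ (q i)) (inj₂ (rayΔ n , j)) eq with ray-interval n j
  ... | u , b with interval-unique {i} {n} ≤-refl (pos-inc i) (subst (pos n ≤_) (sym (rayL-injective eq)) u)
                                                 (subst (_< pos (suc n)) (sym (rayL-injective eq)) b)
  ... | refl = ⊥-elim (<⇒≢ (s≤s (m≤m+n (pos n) (toℕ j))) (rayL-injective eq))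
  label-inj (inj₂ (apexA n , j)) (inj₁ apexΔ) ()
  label-inj (inj₂ (apexA n , j)) (inj₁ (a n')) ()
  label-inj (inj₂ (apexA n , j)) (inj₁ (q k)) ()
  label-inj (inj₂ (apexA n , j)) (inj₂ (apexA n' , j')) eq with spokeL-injective eq
  ... | refl , j≡j' = cong (λ z → inj₂ (apexA n , z)) (toℕ-injective j≡j')
  label-inj (inj₂ (apexA n , j)) (inj₂ (rayΔ k , j')) ()
  label-inj (inj₂ (rayΔ k , j)) (inj₁ apexΔ) ()
  label-inj (inj₂ (rayΔ k , j)) (inj₁ (a n)) ()
  label-inj (inj₂ (rayΔ n , j)) (inj₁ (q i)) eq = sym (label-inj (inj₁ (q i)) (inj₂ (rayΔ n , j)) (sym eq))
  label-inj (inj₂ (rayΔ k , j)) (inj₂ (apexA n , j')) ()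
  label-inj (inj₂ (rayΔ n , j)) (inj₂ (rayΔ n' , j')) eq with ray-interval n j | ray-interval n' j'
  ... | u , b | u' , b' with interval-unique u b (subst (pos n' ≤_) (sym (rayL-injective eq)) u')
                                               (subst (_< pos (suc n')) (sym (rayL-injective eq)) b')
  ... | refl = cong (λ z → inj₂ (rayΔ n , z)) (toℕ-injective (+-cancelˡ-≡ (pos n) _ _ (suc-injective (rayL-injective eq))))

  labelAt : FΔE → ℕ → Label
  labelAt edge k = label (edgeWalk FΔ σ edge k)

  labelAt-spoke-inner : ∀ n k → k < m n → labelAt (apexA n) (suc k) ≡ spokeL n k
  labelAt-spoke-inner n k lt =
    trans (cong label (walk-inner-< (m n) _ _ _ k lt)) (cong (spokeL n) (toℕ-fromℕ< lt))

  labelAt-spoke-last : ∀ n k → k ≡ m n → labelAt (apexA n) (suc k) ≡ triL n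
  labelAt-spoke-last n k refl = cong label (walk-last (m n) _ _ _)

  labelAt-ray : ∀ n k → k ≤ suc (σ (rayΔ n)) → labelAt (rayΔ n) k ≡ rayL (pos n + k)
  labelAt-ray n zero h = cong rayL (sym (+-identityʳ (pos n)))
  labelAt-ray n (suc k) (s≤s h) with m≤n⇒m<n∨m≡n h
  ... | inj₁ lt = trans (cong label (walk-inner-< (σ (rayΔ n)) _ _ _ k lt))
                        (cong rayL (trans (cong (λ z → suc (pos n + z)) (toℕ-fromℕ< lt)) (sym (+-suc (pos n) k))))
  ... | inj₂ refl = trans (cong label (walk-last (σ (rayΔ n)) _ _ _))
                          (cong rayL (sym (trans (+-suc (pos n) _) (m+[n∸m]≡n (pos-inc n)))))

  walk-∼ : ∀ edge k → k ≤ σ edge → labelAt edge k ∼ labelAt edge (suc k)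
  walk-∼ (apexA n) zero _ = first-step (m n) refl
    where
      first-step : ∀ z → m n ≡ z → labelAt (apexA n) 0 ∼ labelAt (apexA n) 1
      first-step zero eq = subst (apexL ∼_) (sym (labelAt-spoke-last n 0 (sym eq))) (apex-tri n eq)
      first-step (suc z) eq = subst (apexL ∼_) (sym (labelAt-spoke-inner n 0 0<m)) (apex-spoke n 0<m)
        where 0<m : 0 < m n
              0<m = subst (0 <_) (sym eq) (s≤s z≤n)
  walk-∼ (apexA n) (suc k) h with m≤n⇒m<n∨m≡n h
  ... | inj₁ lt = subst₂ _∼_ (sym (labelAt-spoke-inner n k (<-trans (n<1+n k) lt)))
                             (sym (labelAt-spoke-inner n (suc k) lt)) (spoke-spoke n k lt)
  ... | inj₂ eq = subst₂ _∼_ (sym (labelAt-spoke-inner n k (≤-reflexive eq)))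
                             (sym (labelAt-spoke-last n (suc k) eq)) (spoke-tri n k eq)
  walk-∼ (aQ₁ n) zero _ = subst (triL n ∼_) (cong rayL (sym (pos-even n))) (tri-ray₁ n)
  walk-∼ (aQ₂ n) zero _ = subst (triL n ∼_) (cong rayL (sym (pos-odd n))) (tri-ray₂ n)
  walk-∼ (rayΔ n) k h = subst₂ _∼_ (sym (labelAt-ray n k (m≤n⇒m≤1+n h)))
     (sym (trans (labelAt-ray n (suc k) (s≤s h)) (cong rayL (+-suc (pos n) k))))
     (ray-ray (pos n + k) (≤-trans (mono-≤ z≤n) (m≤m+n (pos n) k)))

  ∼-walk : ∀ {α β} → α ∼ β → Σ FΔE λ edge → Σ ℕ λ k →
           k ≤ σ edge × labelAt edge k ≡ α × labelAt edge (suc k) ≡ β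
  ∼-walk (apex-spoke n x) = apexA n , 0 , z≤n , refl , labelAt-spoke-inner n 0 x
  ∼-walk (apex-tri n x) = apexA n , 0 , z≤n , refl , labelAt-spoke-last n 0 (sym x)
  ∼-walk (spoke-spoke n j x) =
    apexA n , suc j , <⇒≤ x , labelAt-spoke-inner n j (<-trans (n<1+n j) x) , labelAt-spoke-inner n (suc j) x
  ∼-walk (spoke-tri n j x) =
    apexA n , suc j , ≤-reflexive x , labelAt-spoke-inner n j (≤-reflexive x) , labelAt-spoke-last n (suc j) x
  ∼-walk (tri-ray₁ n) = aQ₁ n , 0 , z≤n , refl , cong rayL (pos-even n)
  ∼-walk (tri-ray₂ n) = aQ₂ n , 0 , z≤n , refl , cong rayL (pos-odd n)
  ∼-walk (ray-ray i x) with interval-locate i x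
  ... | n , u , b =
    rayΔ n , i ∸ pos n , k≤ , trans (labelAt-ray n (i ∸ pos n) (m≤n⇒m≤1+n k≤)) (cong rayL (m+[n∸m]≡n u)) ,
    trans (labelAt-ray n (suc (i ∸ pos n)) (s≤s k≤)) (cong rayL (trans (+-suc (pos n) _) (cong suc (m+[n∸m]≡n u))))
    where k≤ : i ∸ pos n ≤ σ (rayΔ n)
          k≤ = ≤-trans (suc[m]≤n⇒m≤pred[n] (∸-monoˡ-< b u)) (≤-reflexive (pred[m∸n]≡m∸[1+n] (pos (suc n)) (pos n)))

  labelling : LabelledSubdivision FΔ σ
  labelling = record
    { Label = Label ; label = label ; label-inj = label-inj ; Valid = Valid ; label-valid = label-valid
    ; _∼_ = _∼_ ; walk-∼ = walk-∼ ; ∼-walk = ∼-walk }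

  open LabelledSubdivision labelling public using (induced-copy)

-- Paths

clamp : ∀ n → ℕ → Fin (suc n)
clamp n zero = zero
clamp zero (suc i) = zero
clamp (suc n) (suc i) = suc (clamp n i)

toℕ-clamp : ∀ n i → i ≤ n → toℕ (clamp n i) ≡ i
toℕ-clamp n zero _ = refl
toℕ-clamp (suc n) (suc i) (s≤s h) = cong suc (toℕ-clamp n i h)

clamp-toℕ : ∀ n (j : Fin (suc n)) → clamp n (toℕ j) ≡ j
clamp-toℕ n zero = refl
clamp-toℕ (suc n) (suc j) = cong suc (clamp-toℕ n j)

module _ {G : Graph} where

  -- Positions beyond len P are clamped to the last vertex.
  _!_ : Path G → ℕ → V G
  P ! i = at P (clamp (len P) i)

  at≡! : ∀ (P : Path G) j → at P j ≡ P ! toℕ j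
  at≡! P j = cong (at P) (sym (clamp-toℕ (len P) j))

  last≡! : ∀ (P : Path G) → last {G} P ≡ P ! len P
  last≡! P = trans (at≡! P (fromℕ (len P))) (cong (P !_) (toℕ-fromℕ (len P)))

  !-injective : ∀ (P : Path G) {i i'} → i ≤ len P → i' ≤ len P → P ! i ≡ P ! i' → i ≡ i'
  !-injective P {i} {i'} h h' eq = trans (sym (toℕ-clamp _ i h)) (trans (cong toℕ (inj P eq)) (toℕ-clamp _ i' h'))

  !-adjacent : ∀ (P : Path G) i → suc i ≤ len P → E G (P ! i) (P ! suc i)
  !-adjacent P i h = subst₂ (E G) (trans (at≡! P _) (cong (P !_) (trans (toℕ-inject₁ j) (toℕ-fromℕ< h))))
                                  (trans (at≡! P _) (cong ((P !_) ∘ suc) (toℕ-fromℕ< h))) (adj P j)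
    where j = fromℕ< h

  OnPath⇒! : ∀ (P : Path G) {x} → OnPath P x → Σ ℕ λ i → i ≤ len P × P ! i ≡ x
  OnPath⇒! P (j , eq) = toℕ j , toℕ≤pred[n] j , trans (sym (at≡! P j)) eq

  !-OnPath : ∀ (P : Path G) i → OnPath P (P ! i)
  !-OnPath P i = clamp (len P) i , refl

  mkPath : (n : ℕ) (f : ℕ → V G) → (∀ {i i'} → i ≤ n → i' ≤ n → f i ≡ f i' → i ≡ i') →
           (∀ i → suc i ≤ n → E G (f i) (f (suc i))) → Path G
  mkPath n f f-inj f-adj = record
    { len = n
    ; at = λ j → f (toℕ j)
    ; inj = λ {j} {j'} eq → toℕ-injective (f-inj (toℕ≤pred[n] j) (toℕ≤pred[n] j') eq)
    ; adj = λ j → subst (λ z → E G (f z) (f (suc (toℕ j)))) (sym (toℕ-inject₁ j)) (f-adj (toℕ j) (toℕ<n j)) }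

  !-PathIn : ∀ {S : V G → Set} (P : Path G) → PathIn S P → ∀ i → S (P ! i)
  !-PathIn P s i = s (clamp (len P) i)

prefix-then : {A : Set} → ℕ → (ℕ → A) → A → ℕ → A
prefix-then j f y i with i ≤? j
... | yes _ = f i
... | no _ = y

prefix-then-≤ : {A : Set} {j : ℕ} {f : ℕ → A} {y : A} {i : ℕ} → i ≤ j → prefix-then j f y i ≡ f i
prefix-then-≤ {j = j} {i = i} h with i ≤? j
... | yes _ = refl
... | no n = ⊥-elim (n h)

prefix-then-> : {A : Set} {j : ℕ} {f : ℕ → A} {y : A} {i : ℕ} → j < i → prefix-then j f y i ≡ y
prefix-then-> {j = j} {i = i} h with i ≤? j
... | yes le = ⊥-elim (<⇒≱ h le)
... | no _ = refl

skip-after : {A : Set} → ℕ → ℕ → (ℕ → A) → ℕ → A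
skip-after j s f i with i ≤? j
... | yes _ = f i
... | no _ = f (i + s)

skip-after-≤ : {A : Set} {j s : ℕ} {f : ℕ → A} {i : ℕ} → i ≤ j → skip-after j s f i ≡ f i
skip-after-≤ {j = j} {i = i} h with i ≤? j
... | yes _ = refl
... | no n = ⊥-elim (n h)

skip-after-> : {A : Set} {j s : ℕ} {f : ℕ → A} {i : ℕ} → j < i → skip-after j s f i ≡ f (i + s)
skip-after-> {j = j} {i = i} h with i ≤? j
... | yes le = ⊥-elim (<⇒≱ h le)
... | no _ = refl

module PathSurgery {G : Graph} (P : Path G) where

  prefix : ∀ j → j ≤ len P → Path G
  prefix j j≤ = mkPath {G} j (P !_) (λ {i} {i'} h h' → !-injective P (≤-trans h j≤) (≤-trans h' j≤)) (λ i h → !-adjacent P i (≤-trans h j≤))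

  prefix-last : ∀ j (j≤ : j ≤ len P) → last {G} (prefix j j≤) ≡ P ! j
  prefix-last j j≤ = cong (P !_) (toℕ-fromℕ j)

  prefix-PathIn : ∀ {S} j (j≤ : j ≤ len P) → PathIn S P → PathIn S (prefix j j≤)
  prefix-PathIn {S} j j≤ s j' = !-PathIn {S = S} P s (toℕ j')

  module PrefixThen (j : ℕ) (y : V G) (j≤ : j ≤ len P) (fresh : ∀ i → i ≤ j → P ! i ≢ y)
                    (edge : E G (P ! j) y) where

    f : ℕ → V G
    f = prefix-then j (P !_) y

    f-≤ : ∀ {i} → i ≤ j → f i ≡ P ! i
    f-≤ = prefix-then-≤

    f-> : ∀ {i} → j < i → f i ≡ y
    f-> = prefix-then->

    f-inj : ∀ {i i'} → i ≤ suc j → i' ≤ suc j → f i ≡ f i' → i ≡ i'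
    f-inj {i} {i'} hi hi' eq with ≤-<-connex i j | ≤-<-connex i' j
    ... | inj₁ u | inj₁ u' = !-injective P (≤-trans u j≤) (≤-trans u' j≤)
                               (trans (sym (f-≤ u)) (trans eq (f-≤ u')))
    ... | inj₁ u | inj₂ u' = ⊥-elim (fresh i u (trans (sym (f-≤ u)) (trans eq (f-> u'))))
    ... | inj₂ u | inj₁ u' = ⊥-elim (fresh i' u' (trans (sym (f-≤ u')) (trans (sym eq) (f-> u))))
    ... | inj₂ u | inj₂ u' = trans (≤-antisym hi u) (sym (≤-antisym hi' u'))

    f-adj : ∀ i → suc i ≤ suc j → E G (f i) (f (suc i))
    f-adj i (s≤s h) with ≤-<-connex (suc i) j
    ... | inj₁ u = subst₂ (E G) (sym (f-≤ h)) (sym (f-≤ u)) (!-adjacent P i (≤-trans u j≤))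
    ... | inj₂ u with ≤-antisym h (≤-pred u)
    ... | refl = subst₂ (E G) (sym (f-≤ h)) (sym (f-> ≤-refl)) edge

    path : Path G
    path = mkPath {G} (suc j) f f-inj f-adj

    path-last : last {G} path ≡ y
    path-last = trans (cong f (toℕ-fromℕ (suc j))) (f-> ≤-refl)

    path-PathIn : ∀ {S} → PathIn S P → S y → PathIn S path
    path-PathIn {S} s sy j' = in-S (toℕ j')
      where in-S : ∀ i → S (f i)
            in-S i with i ≤? j
            ... | yes _ = !-PathIn {S = S} P s i
            ... | no _ = sy

  module Shortcut (j j' : ℕ) (j+1<j' : suc j < j') (j'≤ : j' ≤ len P) (chord : E G (P ! j) (P ! j')) where

    s : ℕ
    s = j' ∸ suc j

    n : ℕ
    n = len P ∸ s

    1+j+s≡j' : suc j + s ≡ j'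
    1+j+s≡j' = m+[n∸m]≡n (<⇒≤ j+1<j')

    s≤len : s ≤ len P
    s≤len = ≤-trans (m∸n≤m j' (suc j)) j'≤

    j<len : j < len P
    j<len = <-≤-trans (<-trans (n<1+n j) j+1<j') j'≤

    shifted≤len : ∀ i → i ≤ n → i + s ≤ len P
    shifted≤len i h = subst (i + s ≤_) (m∸n+n≡m s≤len) (+-monoˡ-≤ s h)

    j<n : j < n
    j<n = m+n≤o⇒m≤o∸n (suc j) (subst (_≤ len P) (sym 1+j+s≡j') j'≤)

    f : ℕ → V G
    f = skip-after j s (P !_)

    f-≤ : ∀ {i} → i ≤ j → f i ≡ P ! i
    f-≤ = skip-after-≤

    f-> : ∀ {i} → j < i → f i ≡ P ! (i + s)
    f-> = skip-after->

    f-inj : ∀ {i i'} → i ≤ n → i' ≤ n → f i ≡ f i' → i ≡ i'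
    f-inj {i} {i'} hi hi' eq with ≤-<-connex i j | ≤-<-connex i' j
    ... | inj₁ u | inj₁ u' = !-injective P (≤-trans u (<⇒≤ j<len)) (≤-trans u' (<⇒≤ j<len))
                               (trans (sym (f-≤ u)) (trans eq (f-≤ u')))
    ... | inj₁ u | inj₂ u' = ⊥-elim (<⇒≱ (≤-trans u' (m≤m+n i' s)) (≤-trans (≤-reflexive (sym i≡)) u))
      where i≡ : i ≡ i' + s
            i≡ = !-injective P (≤-trans u (<⇒≤ j<len)) (shifted≤len i' hi')
                   (trans (sym (f-≤ u)) (trans eq (f-> u')))
    ... | inj₂ u | inj₁ u' = ⊥-elim (<⇒≱ (≤-trans u (m≤m+n i s)) (≤-trans (≤-reflexive (sym i'≡)) u'))
      where i'≡ : i' ≡ i + s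
            i'≡ = !-injective P (≤-trans u' (<⇒≤ j<len)) (shifted≤len i hi)
                    (trans (sym (f-≤ u')) (trans (sym eq) (f-> u)))
    ... | inj₂ u | inj₂ u' = +-cancelʳ-≡ s i i' (!-injective P (shifted≤len i hi) (shifted≤len i' hi')
                               (trans (sym (f-> u)) (trans eq (f-> u'))))

    f-adj : ∀ i → suc i ≤ n → E G (f i) (f (suc i))
    f-adj i h with ≤-<-connex (suc i) j | ≤-<-connex i j
    ... | inj₁ u | _ = subst₂ (E G) (sym (f-≤ (<⇒≤ u))) (sym (f-≤ u)) (!-adjacent P i (≤-trans u (<⇒≤ j<len)))
    ... | inj₂ u | inj₁ u' with ≤-antisym u' (≤-pred u)
    ... | refl = subst₂ (E G) (sym (f-≤ u')) (sym (trans (f-> ≤-refl) (cong (P !_) 1+j+s≡j'))) chord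
    f-adj i h | inj₂ u | inj₂ u' =
      subst₂ (E G) (sym (f-> u')) (sym (f-> u)) (!-adjacent P (i + s) (shifted≤len (suc i) h))

    path : Path G
    path = mkPath {G} n f f-inj f-adj

    path-shorter : len path < len P
    path-shorter = ∸-monoʳ-< {len P} {s} {0} (m<n⇒0<n∸m j+1<j') s≤len

    path-last : last {G} path ≡ P ! len P
    path-last = trans (cong f (toℕ-fromℕ n)) (trans (f-> j<n) (cong (P !_) (m∸n+n≡m s≤len)))

    path-PathIn : ∀ {S} → PathIn S P → PathIn S path
    path-PathIn {S} s' j' = in-S (toℕ j')
      where in-S : ∀ i → S (f i)
            in-S i with i ≤? j
            ... | yes _ = !-PathIn {S = S} P s' i
            ... | no _ = !-PathIn {S = S} P s' (i + s)

  suffix : ∀ k → k ≤ len P → Path G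
  suffix k k≤ = mkPath {G} (len P ∸ k) (λ t → P ! (k + t)) inj' adj'
    where
      k+t≤len : ∀ {t} → t ≤ len P ∸ k → k + t ≤ len P
      k+t≤len h = subst (k + _ ≤_) (m+[n∸m]≡n k≤) (+-monoʳ-≤ k h)
      inj' : ∀ {i i'} → i ≤ len P ∸ k → i' ≤ len P ∸ k → P ! (k + i) ≡ P ! (k + i') → i ≡ i'
      inj' h h' eq = +-cancelˡ-≡ k _ _ (!-injective P (k+t≤len h) (k+t≤len h') eq)
      adj' : ∀ i → suc i ≤ len P ∸ k → E G (P ! (k + i)) (P ! (k + suc i))
      adj' i h = subst (λ z → E G (P ! (k + i)) (P ! z)) (sym (+-suc k i))
                   (!-adjacent P (k + i) (subst (_≤ len P) (+-suc k i) (k+t≤len h)))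

  suffix-last : ∀ k (k≤ : k ≤ len P) → last {G} (suffix k k≤) ≡ P ! len P
  suffix-last k k≤ = trans (cong (λ t → P ! (k + t)) (toℕ-fromℕ (len P ∸ k))) (cong (P !_) (m+[n∸m]≡n k≤))

  suffix-PathIn : ∀ {S} k (k≤ : k ≤ len P) → PathIn S P → PathIn S (suffix k k≤)
  suffix-PathIn {S} k k≤ s j = !-PathIn {S = S} P s (k + toℕ j)

m<n⇒pred[n]<n : ∀ {x j} → x < j → pred j < j
m<n⇒pred[n]<n {j = suc j} _ = ≤-refl

1+k≤t∸x⇒x<t∸k : ∀ x t k → suc k ≤ t ∸ x → x < t ∸ k
1+k≤t∸x⇒x<t∸k zero zero k ()
1+k≤t∸x⇒x<t∸k zero (suc t) zero h = s≤s z≤n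
1+k≤t∸x⇒x<t∸k zero (suc t) (suc k) (s≤s h) = 1+k≤t∸x⇒x<t∸k zero t k h
1+k≤t∸x⇒x<t∸k (suc x) zero k ()
1+k≤t∸x⇒x<t∸k (suc x) (suc t) k h = subst (suc x <_) (sym (+-∸-assoc 1 k≤t)) (s≤s (1+k≤t∸x⇒x<t∸k x t k h))
  where k≤t : k ≤ t
        k≤t = ≤-trans (n≤1+n k) (≤-trans h (m∸n≤m t x))

-- Combs

record Comb (G : Graph) (v : V G) : Set where
  field
    top         : ℕ → ℕ
    attach      : ℕ → ℕ
    attach≤top  : ∀ n → attach n ≤ top n
    C           : ℕ → ℕ → V G
    C-injective : ∀ {n j n' j'} → j ≤ top n → j' ≤ top n' → C n j ≡ C n' j' → n ≡ n' × j ≡ j'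
    C≢v         : ∀ n j → C n j ≢ v
    leg-edge    : ∀ n j → suc j ≤ top n → E G (C n j) (C n (suc j))
    attach-edge : ∀ n → E G (C (suc n) (top (suc n))) (C n (attach n))
    edge-cases  : ∀ {n j n' j'} → j ≤ top n → j' ≤ top n' → E G (C n j) (C n' j') →
           (n ≡ n' × (j' ≡ suc j ⊎ j ≡ suc j'))
           ⊎ (n' ≡ suc n × j' ≡ top n' × j ≤ attach n)
           ⊎ (n ≡ suc n' × j ≡ top n × j' ≤ attach n')
    v-foot      : ∀ n → E G v (C n 0)

module Spine {G : Graph} {v : V G} (K : Comb G v) where
  open Comb K

  OnSpine : ℕ × ℕ → Set
  OnSpine (n , j) = attach n ≤ j × j ≤ top n

  _≺_ : ℕ × ℕ → ℕ × ℕ → Set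
  (n , j) ≺ (n' , j') = n < n' ⊎ (n ≡ n' × j' < j)

  ≺-trans : ∀ {x y z} → x ≺ y → y ≺ z → x ≺ z
  ≺-trans (inj₁ u) (inj₁ u') = inj₁ (<-trans u u')
  ≺-trans (inj₁ u) (inj₂ (refl , _)) = inj₁ u
  ≺-trans (inj₂ (refl , _)) (inj₁ u') = inj₁ u'
  ≺-trans (inj₂ (refl , u)) (inj₂ (refl , u')) = inj₂ (refl , <-trans u' u)

  ≺-irr : ∀ {x} → ¬ (x ≺ x)
  ≺-irr (inj₁ u) = <-irrefl refl u
  ≺-irr (inj₂ (_ , u)) = <-irrefl refl u

  next-by : ∀ n j → Dec (attach n < j) → ℕ × ℕ
  next-by n j (yes _) = n , pred j
  next-by n j (no _) = suc n , top (suc n)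

  next : ℕ × ℕ → ℕ × ℕ
  next (n , j) = next-by n j (attach n <? j)

  next-OnSpine : ∀ x → OnSpine x → OnSpine (next x)
  next-OnSpine (n , j) (h1 , h2) with attach n <? j
  ... | yes lt = <⇒≤pred lt , ≤-trans (pred-mono-≤ h2) (pred[n]≤n {top n})
  ... | no _ = attach≤top (suc n) , ≤-refl

  ≺-next : ∀ x → OnSpine x → x ≺ next x
  ≺-next (n , j) (h1 , h2) with attach n <? j
  ... | yes lt = inj₂ (refl , m<n⇒pred[n]<n lt)
  ... | no _ = inj₁ (n<1+n n)

  spine : ℕ → ℕ × ℕ
  spine zero = 0 , top 0
  spine (suc g) = next (spine g)

  leg height : ℕ → ℕ
  leg g = proj₁ (spine g)
  height g = proj₂ (spine g)

  spine-OnSpine : ∀ g → OnSpine (spine g)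
  spine-OnSpine zero = attach≤top 0 , ≤-refl
  spine-OnSpine (suc g) = next-OnSpine (spine g) (spine-OnSpine g)

  spine-≺ : ∀ {g h} → g < h → spine g ≺ spine h
  spine-≺ {g} {suc h} (s≤s g≤h) with m≤n⇒m<n∨m≡n g≤h
  ... | inj₁ lt = ≺-trans (spine-≺ lt) (≺-next (spine h) (spine-OnSpine h))
  ... | inj₂ refl = ≺-next (spine g) (spine-OnSpine g)

  spine-≺⁻¹ : ∀ {g h} → spine g ≺ spine h → g < h
  spine-≺⁻¹ {g} {h} pp with <-cmp g h
  ... | tri< lt _ _ = lt
  ... | tri≈ _ refl _ = ⊥-elim (≺-irr pp)
  ... | tri> _ _ gt = ⊥-elim (≺-irr (≺-trans pp (spine-≺ gt)))

  spine-injective : ∀ {g h} → spine g ≡ spine h → g ≡ h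
  spine-injective {g} {h} eq with <-cmp g h
  ... | tri< lt _ _ = ⊥-elim (≺-irr (subst (_≺ spine h) eq (spine-≺ lt)))
  ... | tri≈ _ e _ = e
  ... | tri> _ _ gt = ⊥-elim (≺-irr (subst (spine h ≺_) eq (spine-≺ gt)))

  leg-mono : ∀ {g h} → g ≤ h → leg g ≤ leg h
  leg-mono {g} {h} le with m≤n⇒m<n∨m≡n le
  ... | inj₂ refl = ≤-refl
  ... | inj₁ lt with spine-≺ lt
  ... | inj₁ u = <⇒≤ u
  ... | inj₂ (e , _) = ≤-reflexive e

  spine-enters : ∀ n → Σ ℕ λ g → spine g ≡ (n , top n)
  spine-descends : ∀ n g → spine g ≡ (n , top n) → ∀ k → k ≤ top n ∸ attach n → spine (g + k) ≡ (n , top n ∸ k)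
  spine-enters zero = 0 , refl
  spine-enters (suc n) with spine-enters n
  ... | g , eq = suc (g + d) , trans (cong next (trans (spine-descends n g eq d ≤-refl) (cong (n ,_) (m∸[m∸n]≡n (attach≤top n))))) lem
    where d = top n ∸ attach n
          lem : next (n , attach n) ≡ (suc n , top (suc n))
          lem with attach n <? attach n
          ... | yes lt = ⊥-elim (<-irrefl refl lt)
          ... | no _ = refl
  spine-descends n g eq zero _ = trans (cong spine (+-identityʳ g)) eq
  spine-descends n g eq (suc k) le = trans (cong spine (+-suc g k)) (trans (cong next (spine-descends n g eq k (<⇒≤ le))) lem)
    where lem : next (n , top n ∸ k) ≡ (n , top n ∸ suc k)
          lem with attach n <? top n ∸ k
          ... | yes _ = cong (n ,_) (pred[m∸n]≡m∸[1+n] (top n) k)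
          ... | no nlt = ⊥-elim (nlt (1+k≤t∸x⇒x<t∸k (attach n) (top n) k le))

  spine-surjective : ∀ n j → attach n ≤ j → j ≤ top n → Σ ℕ λ g → spine g ≡ (n , j)
  spine-surjective n j h1 h2 with spine-enters n
  ... | g , eq = g + (top n ∸ j) , trans (spine-descends n g eq (top n ∸ j) (∸-monoʳ-≤ (top n) h1)) (cong (n ,_) (m∸[m∸n]≡n h2))

  vertex : ℕ × ℕ → V G
  vertex x = C (proj₁ x) (proj₂ x)

  spineV : ℕ → V G
  spineV g = vertex (spine g)

  next-descend : ∀ n j → attach n ≤ j → next (n , suc j) ≡ (n , j)
  next-descend n j h with attach n <? suc j
  ... | yes _ = refl
  ... | no nlt = ⊥-elim (nlt (s≤s h))

  next-attach : ∀ n → next (n , attach n) ≡ (suc n , top (suc n))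
  next-attach n with attach n <? attach n
  ... | yes lt = ⊥-elim (<-irrefl refl lt)
  ... | no _ = refl

  next-edge : ∀ n j → OnSpine (n , j) → E G (C n j) (vertex (next (n , j)))
  next-edge n zero (h1 , h2) with attach n <? zero
  ... | no _ = subst (λ z → E G (C n z) (C (suc n) (top (suc n)))) (n≤0⇒n≡0 h1) (E-sym G (attach-edge n))
  next-edge n (suc j) (h1 , h2) with attach n <? suc j
  ... | yes _ = E-sym G (leg-edge n j h2)
  ... | no nlt = subst (λ z → E G (C n z) (C (suc n) (top (suc n)))) (sym (≤-antisym (≮⇒≥ nlt) h1)) (E-sym G (attach-edge n))

  spine-edge : ∀ g → E G (spineV g) (spineV (suc g))
  spine-edge g = next-edge (leg g) (height g) (spine-OnSpine g)

  spine-edge-cases : ∀ g h → E G (spineV g) (spineV h) → h ≡ suc g ⊎ g ≡ suc h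
  spine-edge-cases g h ed with spine-OnSpine g | spine-OnSpine h | edge-cases (proj₂ (spine-OnSpine g)) (proj₂ (spine-OnSpine h)) ed
  ... | og1 , og2 | oh1 , oh2 | inj₁ (e1 , inj₁ e2) =
        inj₂ (spine-injective (sym (trans (cong next (cong₂ _,_ (sym e1) e2)) (next-descend (leg g) (height g) og1))))
  ... | og1 , og2 | oh1 , oh2 | inj₁ (e1 , inj₂ e2) =
        inj₁ (sym (spine-injective (trans (cong next (cong₂ _,_ e1 e2)) (next-descend (leg h) (height h) oh1))))
  ... | og1 , og2 | oh1 , oh2 | inj₂ (inj₁ (e1 , e2 , e3)) =
        inj₁ (sym (spine-injective (trans (cong next (cong (leg g ,_) (≤-antisym e3 og1))) (trans (next-attach (leg g)) (cong₂ _,_ (sym e1) (sym (trans e2 (cong top e1))))))))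
  ... | og1 , og2 | oh1 , oh2 | inj₂ (inj₂ (e1 , e2 , e3)) =
        inj₂ (sym (spine-injective (trans (cong next (cong (leg h ,_) (≤-antisym e3 oh1))) (trans (next-attach (leg h)) (cong₂ _,_ (sym e1) (sym (trans e2 (cong top e1))))))))

Unbounded : (ℕ → Set) → Set
Unbounded P = ∀ N → Σ ℕ λ n → N ≤ n × P n

EventuallyNot : (ℕ → Set) → Set
EventuallyNot P = Σ ℕ λ N → ∀ n → N ≤ n → ¬ P n

unbounded-or-eventually-not : ExcludedMiddle 0ℓ → (P : ℕ → Set) → Unbounded P ⊎ EventuallyNot P
unbounded-or-eventually-not em P with em {EventuallyNot P}
... | yes ev = inj₂ ev
... | no ¬ev = inj₁ unbounded
  where
    unbounded : Unbounded P
    unbounded N with em {Σ ℕ λ n → N ≤ n × P n}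
    ... | yes w = w
    ... | no ¬w = ⊥-elim (¬ev (N , λ n N≤n pn → ¬w (n , N≤n , pn)))

-- Gaps of at least two, since the spoke on leg n may reach the spine on leg n + 1.
module Sparse (P : ℕ → Set) (unbounded : Unbounded P) where

  ν : ℕ → ℕ
  ν zero = proj₁ (unbounded 0)
  ν (suc k) = proj₁ (unbounded (suc (suc (ν k))))

  ν-property : ∀ k → P (ν k)
  ν-property zero = proj₂ (proj₂ (unbounded 0))
  ν-property (suc k) = proj₂ (proj₂ (unbounded (suc (suc (ν k)))))

  ν-gap : ∀ k → suc (suc (ν k)) ≤ ν (suc k)
  ν-gap k = proj₁ (proj₂ (unbounded (suc (suc (ν k)))))

  ν-inc : ∀ k → ν k < ν (suc k)
  ν-inc k = ≤-trans (n≤1+n _) (ν-gap k)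

  open StrictlyIncreasing ν ν-inc public using () renaming (injective to ν-injective)

Conclusion : Graph → Set
Conclusion G = Σ (F∞E → ℕ) (λ σ → InducedCopy G F∞ σ) ⊎ Σ (FΔE → ℕ) (λ σ → AllowedΔ σ × InducedCopy G FΔ σ)

module CombAnalysis {G : Graph} {v : V G} (em : ExcludedMiddle 0ℓ) (K : Comb G v) where
  open Comb K
  open Spine K

  v∼spine : ℕ → Set
  v∼spine i = E G v (spineV i)

  spineV-injective : ∀ i i' → spineV i ≡ spineV i' → i ≡ i'
  spineV-injective i i' eq with C-injective (proj₂ (spine-OnSpine i)) (proj₂ (spine-OnSpine i')) eq
  ... | e1 , e2 = spine-injective (cong₂ _,_ e1 e2)

  -- The apex is v and the branch vertices are the successive spine neighbours of v.
  module ManySpineNeighbours (unbounded : Unbounded v∼spine) where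

    module From (N : ℕ) = Search (λ i → N ≤ i × v∼spine i) (λ _ → em)

    next-neighbour : ∀ N → ∃ (From.Least N)
    next-neighbour N = From.least N (proj₁ (unbounded N)) (proj₂ (unbounded N))

    e : ℕ → ℕ
    e zero = proj₁ (next-neighbour 0)
    e (suc n) = proj₁ (next-neighbour (suc (e n)))

    e-inc : ∀ n → e n < e (suc n)
    e-inc n = proj₁ (proj₁ (proj₂ (next-neighbour (suc (e n)))))

    v∼spine-e : ∀ n → v∼spine (e n)
    v∼spine-e zero = proj₂ (proj₁ (proj₂ (next-neighbour 0)))
    v∼spine-e (suc n) = proj₂ (proj₁ (proj₂ (next-neighbour (suc (e n)))))

    open StrictlyIncreasing e e-inc
    open F∞Labels e e-inc (λ _ → 0)

    v∼spine⇒e : ∀ i → e 0 ≤ i → v∼spine i → Σ ℕ λ n → i ≡ e n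
    v∼spine⇒e i h vs with interval-locate i h
    ... | n , h1 , h2 with m≤n⇒m<n∨m≡n h1
    ... | inj₂ eq = n , sym eq
    ... | inj₁ lt = ⊥-elim (proj₂ (proj₂ (next-neighbour (suc (e n)))) i h2 (lt , vs))

    embed : Label → V G
    embed apexL = v
    embed (rayL i) = spineV i
    embed (spokeL _ _) = v

    embed-inj : ∀ α β → Valid α → Valid β → embed α ≡ embed β → α ≡ β
    embed-inj apexL apexL _ _ _ = refl
    embed-inj apexL (rayL i) _ _ eq = ⊥-elim (C≢v _ _ (sym eq))
    embed-inj (rayL i) apexL _ _ eq = ⊥-elim (C≢v _ _ eq)
    embed-inj (rayL i) (rayL i') _ _ eq = cong rayL (spineV-injective i i' eq)
    embed-inj _ (spokeL n j) _ () _
    embed-inj (spokeL n j) _ () _ _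

    embed-adj : ∀ α β → α ∼ β → E G (embed α) (embed β)
    embed-adj _ _ (apex-spoke n ())
    embed-adj _ _ (apex-ray n _) = v∼spine-e n
    embed-adj _ _ (spoke-spoke n j ())
    embed-adj _ _ (spoke-ray n j ())
    embed-adj _ _ (ray-ray i _) = spine-edge i

    embed-reflect : ∀ α β → Valid α → Valid β → E G (embed α) (embed β) → α ∼ β ⊎ β ∼ α
    embed-reflect apexL apexL _ _ ed = ⊥-elim (E-irr G ed)
    embed-reflect apexL (rayL i) _ vb ed with v∼spine⇒e i vb ed
    ... | n , refl = inj₁ (apex-ray n refl)
    embed-reflect (rayL i) apexL va _ ed with v∼spine⇒e i va (E-sym G ed)
    ... | n , refl = inj₂ (apex-ray n refl)
    embed-reflect (rayL i) (rayL i') va vb ed with spine-edge-cases i i' ed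
    ... | inj₁ refl = inj₁ (ray-ray i va)
    ... | inj₂ refl = inj₂ (ray-ray i' vb)
    embed-reflect _ (spokeL n j) _ () _
    embed-reflect (spokeL n j) _ () _ _

    conclusion : Conclusion G
    conclusion = inj₁ (σ , induced-copy G embed embed-inj embed-adj embed-reflect)

  lower-leg-edge : ∀ {n x n' y} → x < attach n → y < attach n' → E G (C n x) (C n' y) →
                   n ≡ n' × (y ≡ suc x ⊎ x ≡ suc y)
  lower-leg-edge {n} {x} {n'} {y} hx hy ed
    with edge-cases (≤-trans (<⇒≤ hx) (attach≤top n)) (≤-trans (<⇒≤ hy) (attach≤top n')) ed
  ... | inj₁ same-leg = same-leg
  ... | inj₂ (inj₁ (_ , e2 , _)) = ⊥-elim (<⇒≱ hy (subst (attach n' ≤_) (sym e2) (attach≤top n')))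
  ... | inj₂ (inj₂ (_ , e2 , _)) = ⊥-elim (<⇒≱ hx (subst (attach n ≤_) (sym e2) (attach≤top n)))

  spineV≢lower-leg : ∀ i {n x} → x < attach n → spineV i ≢ C n x
  spineV≢lower-leg i {n} hx eq with C-injective (proj₂ (spine-OnSpine i)) (≤-trans (<⇒≤ hx) (attach≤top n)) eq
  ... | refl , refl = <⇒≱ hx (proj₁ (spine-OnSpine i))

  lower-leg-injective : ∀ {n x n' y} → x < attach n → y < attach n' → C n x ≡ C n' y → n ≡ n' × x ≡ y
  lower-leg-injective {n} {n' = n'} hx hy =
    C-injective (≤-trans (<⇒≤ hx) (attach≤top n)) (≤-trans (<⇒≤ hy) (attach≤top n'))

  module FewSpineNeighbours (N : ℕ) (¬v∼spine-from : ∀ i → N ≤ i → ¬ v∼spine i) where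

    n₀ : ℕ
    n₀ = suc (leg N)

    spine-beyond : ∀ {n j i} → spine i ≡ (n , j) → n₀ ≤ n → N ≤ i
    spine-beyond {n} {j} {i} eq h with N ≤? i
    ... | yes le = le
    ... | no nle = ⊥-elim (<⇒≱ h (subst (_≤ leg N) (cong proj₁ eq) (leg-mono (<⇒≤ (≰⇒> nle)))))

    ¬v∼upper-leg : ∀ n j → n₀ ≤ n → OnSpine (n , j) → ¬ E G v (C n j)
    ¬v∼upper-leg n j h (h1 , h2) ed with spine-surjective n j h1 h2
    ... | i , eq = ¬v∼spine-from i (spine-beyond eq h) (subst (E G v) (cong vertex (sym eq)) ed)

    ¬v∼spine : ∀ i → n₀ ≤ leg i → ¬ E G v (spineV i)
    ¬v∼spine i h = ¬v∼upper-leg (leg i) (height i) h (spine-OnSpine i)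

    attach≥1 : ∀ n → n₀ ≤ n → 1 ≤ attach n
    attach≥1 n h with attach n in eq
    ... | zero = ⊥-elim (¬v∼upper-leg n 0 h (≤-reflexive eq , z≤n) (v-foot n))
    ... | suc _ = s≤s z≤n

    module Chord (n : ℕ) = Search (λ k → E G (C (suc n) (top (suc n))) (C n k)) (λ _ → em)

    opaque
      lowest-chord : ∀ n → ∃ (Chord.Least n)
      lowest-chord n = Chord.least n (attach n) (attach-edge n)

    lowest : ℕ → ℕ
    lowest n = proj₁ (lowest-chord n)

    lowest-edge : ∀ n → E G (C (suc n) (top (suc n))) (C n (lowest n))
    lowest-edge n = proj₁ (proj₂ (lowest-chord n))

    lowest-least : ∀ n k → E G (C (suc n) (top (suc n))) (C n k) → lowest n ≤ k
    lowest-least n k ed with lowest n ≤? k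
    ... | yes le = le
    ... | no nle = ⊥-elim (proj₂ (proj₂ (lowest-chord n)) k (≰⇒> nle) ed)

    lowest≤attach : ∀ n → lowest n ≤ attach n
    lowest≤attach n = lowest-least n (attach n) (attach-edge n)

    -- The top of leg n + 1 sees the consecutive vertices C n (attach n - 1) and C n (attach n).
    Triangle : ℕ → Set
    Triangle n = suc (lowest n) ≡ attach n

    -- The spoke on leg n below height B starts at the last v-neighbour.
    module SpokeBase (n B : ℕ) where
      opaque
        base-search : Σ ℕ λ b → b ≤ B × E G v (C n b) × (∀ j → b < j → j ≤ B → ¬ E G v (C n j))
        base-search = Search.greatest≤ (λ k → E G v (C n k)) (λ _ → em) B (v-foot n)

      base : ℕ
      base = proj₁ base-search

      base≤ : base ≤ B
      base≤ = proj₁ (proj₂ base-search)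

      v∼base : E G v (C n base)
      v∼base = proj₁ (proj₂ (proj₂ base-search))

      ¬v∼above-base : ∀ j → base < j → j ≤ B → ¬ E G v (C n j)
      ¬v∼above-base = proj₂ (proj₂ (proj₂ base-search))

      v∼spoke⇒base : ∀ j → base + j ≤ B → E G v (C n (base + j)) → j ≡ 0
      v∼spoke⇒base zero _ _ = refl
      v∼spoke⇒base (suc j) h ed =
        ⊥-elim (¬v∼above-base (base + suc j) (subst (_< base + suc j) (+-identityʳ base) (+-monoʳ-< base (s≤s z≤n))) h ed)

    -- Below the attachment point of a triangle-free leg n, only C n peak has a neighbour on the
    -- spine, and it has exactly one.
    record SpokeEnd (n : ℕ) : Set where
      field
        peak             : ℕ
        peak<attach      : peak < attach n
        end-leg          : ℕ
        end-height       : ℕ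
        end-OnSpine      : OnSpine (end-leg , end-height)
        end-leg≤         : end-leg ≤ suc n
        end-leg≥         : n ≤ end-leg
        peak-edge        : E G (C n peak) (C end-leg end-height)
        peak-edge-unique : ∀ n' j' x → OnSpine (n' , j') → x ≤ peak → E G (C n' j') (C n x) →
                           x ≡ peak × n' ≡ end-leg × j' ≡ end-height

    spoke-end-on-leg : ∀ n → n₀ ≤ n → lowest n ≡ attach n → SpokeEnd n
    spoke-end-on-leg n h eq = record
      { peak = pred (attach n) ; peak<attach = peak<attach
      ; end-leg = n ; end-height = attach n ; end-OnSpine = ≤-refl , attach≤top n
      ; end-leg≤ = n≤1+n n ; end-leg≥ = ≤-refl
      ; peak-edge = subst (λ z → E G (C n (pred (attach n))) (C n z)) pred-suc
          (leg-edge n (pred (attach n)) (subst (_≤ top n) (sym pred-suc) (attach≤top n)))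
      ; peak-edge-unique = unique }
      where
        pred-suc : suc (pred (attach n)) ≡ attach n
        pred-suc = suc-pred-≥1 (attach≥1 n h)
        peak<attach : pred (attach n) < attach n
        peak<attach = subst (pred (attach n) <_) pred-suc ≤-refl
        unique : ∀ n' j' x → OnSpine (n' , j') → x ≤ pred (attach n) → E G (C n' j') (C n x) →
                 x ≡ pred (attach n) × n' ≡ n × j' ≡ attach n
        unique n' j' x (o1 , o2) hx ed with edge-cases o2 (≤-trans hx (≤-trans (<⇒≤ peak<attach) (attach≤top n))) ed
        ... | inj₁ (refl , inj₁ e2) = ⊥-elim (<⇒≱ (≤-<-trans hx peak<attach) (≤-trans o1 (subst (j' ≤_) (sym e2) (n≤1+n j'))))
        ... | inj₁ (refl , inj₂ e2) = x≡peak , refl , trans e2 (trans (cong suc x≡peak) pred-suc)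
          where x≡peak : x ≡ pred (attach n)
                x≡peak = ≤-antisym hx (≤-pred (subst (_≤ suc x) (sym pred-suc) (subst (attach n ≤_) e2 o1)))
        ... | inj₂ (inj₁ (_ , e2 , _)) = ⊥-elim (<⇒≱ (≤-<-trans hx peak<attach) (subst (attach n ≤_) (sym e2) (attach≤top n)))
        ... | inj₂ (inj₂ (refl , refl , _)) = ⊥-elim (<⇒≱ (≤-<-trans hx peak<attach) (subst (_≤ x) eq (lowest-least n x ed)))

    spoke-end-on-chord : ∀ n → lowest n ≢ attach n → ¬ Triangle n → SpokeEnd n
    spoke-end-on-chord n neq no-triangle = record
      { peak = lowest n ; peak<attach = lowest<attach
      ; end-leg = suc n ; end-height = top (suc n) ; end-OnSpine = attach≤top (suc n) , ≤-refl
      ; end-leg≤ = ≤-refl ; end-leg≥ = n≤1+n n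
      ; peak-edge = E-sym G (lowest-edge n)
      ; peak-edge-unique = unique }
      where
        lowest<attach : lowest n < attach n
        lowest<attach = ≤∧≢⇒< (lowest≤attach n) neq
        lowest+1<attach : suc (suc (lowest n)) ≤ attach n
        lowest+1<attach = ≤∧≢⇒< lowest<attach no-triangle
        unique : ∀ n' j' x → OnSpine (n' , j') → x ≤ lowest n → E G (C n' j') (C n x) →
                 x ≡ lowest n × n' ≡ suc n × j' ≡ top (suc n)
        unique n' j' x (o1 , o2) hx ed with edge-cases o2 (≤-trans hx (≤-trans (<⇒≤ lowest<attach) (attach≤top n))) ed
        ... | inj₁ (refl , inj₁ e2) = ⊥-elim (<⇒≱ (≤-<-trans hx lowest<attach) (≤-trans o1 (subst (j' ≤_) (sym e2) (n≤1+n j'))))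
        ... | inj₁ (refl , inj₂ e2) = ⊥-elim (<⇒≱ (≤-trans (s≤s (s≤s hx)) lowest+1<attach) (subst (attach n ≤_) e2 o1))
        ... | inj₂ (inj₁ (_ , e2 , _)) = ⊥-elim (<⇒≱ (≤-<-trans hx lowest<attach) (subst (attach n ≤_) (sym e2) (attach≤top n)))
        ... | inj₂ (inj₂ (refl , refl , _)) = ≤-antisym hx (lowest-least n x ed) , refl , refl

    spoke-end : ∀ n → n₀ ≤ n → ¬ Triangle n → SpokeEnd n
    spoke-end n h no-triangle with lowest n ≟ attach n
    ... | yes eq = spoke-end-on-leg n h eq
    ... | no neq = spoke-end-on-chord n neq no-triangle

    module NoTriangles (M : ℕ) (no-triangle : ∀ n → M ≤ n → ¬ (n₀ ≤ n × Triangle n)) where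

      TriangleFree : ℕ → Set
      TriangleFree n = n₀ ≤ n × ¬ Triangle n

      candidates : Unbounded TriangleFree
      candidates N' = N' + (M + n₀) , m≤m+n N' _ , n₀≤ , λ t → no-triangle _ M≤ (n₀≤ , t)
        where
          n₀≤ : n₀ ≤ N' + (M + n₀)
          n₀≤ = ≤-trans (m≤n+m n₀ M) (m≤n+m _ N')
          M≤ : M ≤ N' + (M + n₀)
          M≤ = ≤-trans (m≤m+n M n₀) (m≤n+m _ N')

      open Sparse TriangleFree candidates

      opaque
        end : ∀ k → SpokeEnd (ν k)
        end k = spoke-end (ν k) (proj₁ (ν-property k)) (proj₂ (ν-property k))

      module End (k : ℕ) = SpokeEnd (end k)
      module Base (k : ℕ) = SpokeBase (ν k) (End.peak k)
      open Base using (base)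

      opaque
        end-pos-search : ∀ k → Σ ℕ λ i → spine i ≡ (End.end-leg k , End.end-height k)
        end-pos-search k = spine-surjective _ _ (proj₁ (End.end-OnSpine k)) (proj₂ (End.end-OnSpine k))

      end-pos : ℕ → ℕ
      end-pos k = proj₁ (end-pos-search k)

      spine-end-pos : ∀ k → spine (end-pos k) ≡ (End.end-leg k , End.end-height k)
      spine-end-pos k = proj₂ (end-pos-search k)

      end-pos-inc : ∀ k → end-pos k < end-pos (suc k)
      end-pos-inc k = spine-≺⁻¹ (subst₂ _≺_ (sym (spine-end-pos k)) (sym (spine-end-pos (suc k)))
        (inj₁ (<-≤-trans (s≤s (End.end-leg≤ k)) (≤-trans (ν-gap k) (End.end-leg≥ (suc k))))))

      spoke-len : ℕ → ℕ
      spoke-len k = suc (End.peak k) ∸ base k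

      spokeV : ℕ → ℕ → V G
      spokeV k j = C (ν k) (base k + j)

      open F∞Labels end-pos end-pos-inc spoke-len

      spoke≤peak : ∀ k j → j < spoke-len k → base k + j ≤ End.peak k
      spoke≤peak k j h = m<1+o∸n⇒n+m≤o {n = base k} h

      spoke<attach : ∀ k j → j < spoke-len k → base k + j < attach (ν k)
      spoke<attach k j h = ≤-<-trans (spoke≤peak k j h) (End.peak<attach k)

      spoke-len>0 : ∀ k → 0 < spoke-len k
      spoke-len>0 k = n≤o⇒0<1+o∸n {base k} (Base.base≤ k)

      leg≥n₀ : ∀ i → end-pos 0 ≤ i → n₀ ≤ leg i
      leg≥n₀ i h = ≤-trans (proj₁ (ν-property 0))
        (≤-trans (End.end-leg≥ 0) (subst (_≤ leg i) (cong proj₁ (spine-end-pos 0)) (leg-mono h)))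

      embed : Label → V G
      embed apexL = v
      embed (rayL i) = spineV i
      embed (spokeL k j) = spokeV k j

      embed-inj : ∀ α β → Valid α → Valid β → embed α ≡ embed β → α ≡ β
      embed-inj apexL apexL _ _ _ = refl
      embed-inj apexL (rayL i) _ _ eq = ⊥-elim (C≢v _ _ (sym eq))
      embed-inj (rayL i) apexL _ _ eq = ⊥-elim (C≢v _ _ eq)
      embed-inj apexL (spokeL k j) _ _ eq = ⊥-elim (C≢v _ _ (sym eq))
      embed-inj (spokeL k j) apexL _ _ eq = ⊥-elim (C≢v _ _ eq)
      embed-inj (rayL i) (rayL i') _ _ eq = cong rayL (spineV-injective i i' eq)
      embed-inj (rayL i) (spokeL k j) _ vb eq = ⊥-elim (spineV≢lower-leg i (spoke<attach k j vb) eq)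
      embed-inj (spokeL k j) (rayL i) va _ eq = ⊥-elim (spineV≢lower-leg i (spoke<attach k j va) (sym eq))
      embed-inj (spokeL k j) (spokeL k' j') va vb eq
        with lower-leg-injective (spoke<attach k j va) (spoke<attach k' j' vb) eq
      ... | e1 , e2 with ν-injective {k} {k'} e1
      ... | refl = cong (spokeL k) (+-cancelˡ-≡ (base k) _ _ e2)

      embed-adj : ∀ α β → α ∼ β → E G (embed α) (embed β)
      embed-adj _ _ (apex-spoke k _) = subst (λ z → E G v (C (ν k) z)) (sym (+-identityʳ (base k))) (Base.v∼base k)
      embed-adj _ _ (apex-ray k eq) = ⊥-elim (<⇒≢ (spoke-len>0 k) (sym eq))
      embed-adj _ _ (spoke-spoke k j h) = subst (λ z → E G (spokeV k j) (C (ν k) z)) (sym (+-suc (base k) j))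
        (leg-edge (ν k) (base k + j) (subst (_≤ top (ν k)) (+-suc (base k) j)
          (<⇒≤ (<-≤-trans (spoke<attach k (suc j) h) (attach≤top (ν k))))))
      embed-adj _ _ (spoke-ray k j eq) =
        subst₂ (λ z z' → E G (C (ν k) z) z') (sym (1+m≡1+o∸n⇒n+m≡o (Base.base≤ k) eq))
               (sym (cong vertex (spine-end-pos k))) (End.peak-edge k)
      embed-adj _ _ (ray-ray i _) = spine-edge i

      spine-spoke-edge : ∀ i k j → j < spoke-len k → E G (spineV i) (spokeV k j) → spokeL k j ∼ rayL i
      spine-spoke-edge i k j h ed
        with End.peak-edge-unique k (leg i) (height i) (base k + j) (spine-OnSpine i) (spoke≤peak k j h) ed
      ... | e1 , e2 , e3 with spine-injective {i} {end-pos k} (trans (cong₂ _,_ e2 e3) (sym (spine-end-pos k)))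
      ... | refl = spoke-ray k j (n+m≡o⇒1+m≡1+o∸n e1)

      embed-reflect : ∀ α β → Valid α → Valid β → E G (embed α) (embed β) → α ∼ β ⊎ β ∼ α
      embed-reflect apexL apexL _ _ ed = ⊥-elim (E-irr G ed)
      embed-reflect apexL (rayL i) _ vb ed = ⊥-elim (¬v∼spine i (leg≥n₀ i vb) ed)
      embed-reflect (rayL i) apexL va _ ed = ⊥-elim (¬v∼spine i (leg≥n₀ i va) (E-sym G ed))
      embed-reflect apexL (spokeL k j) _ vb ed with Base.v∼spoke⇒base k j (spoke≤peak k j vb) ed
      ... | refl = inj₁ (apex-spoke k (spoke-len>0 k))
      embed-reflect (spokeL k j) apexL va _ ed with Base.v∼spoke⇒base k j (spoke≤peak k j va) (E-sym G ed)
      ... | refl = inj₂ (apex-spoke k (spoke-len>0 k))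
      embed-reflect (rayL i) (rayL i') va vb ed with spine-edge-cases i i' ed
      ... | inj₁ refl = inj₁ (ray-ray i va)
      ... | inj₂ refl = inj₂ (ray-ray i' vb)
      embed-reflect (rayL i) (spokeL k j) _ vb ed = inj₂ (spine-spoke-edge i k j vb ed)
      embed-reflect (spokeL k j) (rayL i) va _ ed = inj₁ (spine-spoke-edge i k j va (E-sym G ed))
      embed-reflect (spokeL k j) (spokeL k' j') va vb ed
        with lower-leg-edge (spoke<attach k j va) (spoke<attach k' j' vb) ed
      ... | e1 , rel with ν-injective {k} {k'} e1
      ... | refl with rel
      ... | inj₁ e2 with +-cancelˡ-≡ (base k) j' (suc j) (trans e2 (sym (+-suc (base k) j)))
      ... | refl = inj₁ (spoke-spoke k j vb)
      embed-reflect (spokeL k j) (spokeL k' j') va vb ed | e1 , rel | refl | inj₂ e2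
        with +-cancelˡ-≡ (base k) j (suc j') (trans e2 (sym (+-suc (base k) j')))
      ... | refl = inj₂ (spoke-spoke k j' va)

      conclusion : Conclusion G
      conclusion = inj₁ (σ , induced-copy G embed embed-inj embed-adj embed-reflect)

    module Triangles (triangles : Unbounded (λ n → n₀ ≤ n × Triangle n)) where
      open Sparse (λ n → n₀ ≤ n × Triangle n) triangles

      lowest<attach : ∀ k → lowest (ν k) < attach (ν k)
      lowest<attach k = ≤-reflexive (proj₂ (ν-property k))

      lowest<top : ∀ k → lowest (ν k) < top (ν k)
      lowest<top k = <-≤-trans (lowest<attach k) (attach≤top (ν k))

      opaque
        tri-pos-search : ∀ k → Σ ℕ λ i → spine i ≡ (ν k , attach (ν k))
        tri-pos-search k = spine-surjective (ν k) (attach (ν k)) ≤-refl (attach≤top (ν k))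

      tri-pos : ℕ → ℕ
      tri-pos k = proj₁ (tri-pos-search k)

      spine-tri-pos : ∀ k → spine (tri-pos k) ≡ (ν k , attach (ν k))
      spine-tri-pos k = proj₂ (tri-pos-search k)

      spine-tri-pos+1 : ∀ k → spine (suc (tri-pos k)) ≡ (suc (ν k) , top (suc (ν k)))
      spine-tri-pos+1 k = trans (cong next (spine-tri-pos k)) (next-attach (ν k))

      tri-pos-gap : ∀ k → suc (tri-pos k) < tri-pos (suc k)
      tri-pos-gap k = spine-≺⁻¹ (subst₂ _≺_ (sym (spine-tri-pos+1 k)) (sym (spine-tri-pos (suc k))) (inj₁ (ν-gap k)))

      module Base (k : ℕ) = SpokeBase (ν k) (lowest (ν k))
      open Base using (base)

      spoke-len : ℕ → ℕ
      spoke-len k = lowest (ν k) ∸ base k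

      spokeV : ℕ → ℕ → V G
      spokeV k j = C (ν k) (base k + j)

      triV : ℕ → V G
      triV k = C (ν k) (lowest (ν k))

      open FΔLabels tri-pos tri-pos-gap spoke-len

      spoke<lowest : ∀ k j → j < spoke-len k → base k + j < lowest (ν k)
      spoke<lowest k j h = m<o∸n⇒n+m<o {n = base k} h

      spoke<attach : ∀ k j → j < spoke-len k → base k + j < attach (ν k)
      spoke<attach k j h = <-trans (spoke<lowest k j h) (lowest<attach k)

      tri-edge-unique : ∀ k n' j' x → OnSpine (n' , j') → x ≤ lowest (ν k) → E G (C n' j') (C (ν k) x) →
        x ≡ lowest (ν k) × ((n' ≡ ν k × j' ≡ attach (ν k)) ⊎ (n' ≡ suc (ν k) × j' ≡ top (suc (ν k))))
      tri-edge-unique k n' j' x (o1 , o2) hx ed with edge-cases o2 (≤-trans hx (<⇒≤ (lowest<top k))) ed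
      ... | inj₁ (refl , inj₁ e2) =
        ⊥-elim (<⇒≱ (≤-<-trans hx (lowest<attach k)) (≤-trans o1 (subst (j' ≤_) (sym e2) (n≤1+n j'))))
      ... | inj₁ (refl , inj₂ e2) = x≡lowest , inj₁ (refl , trans e2 (trans (cong suc x≡lowest) (proj₂ (ν-property k))))
        where x≡lowest : x ≡ lowest (ν k)
              x≡lowest = ≤-antisym hx (≤-pred (subst (_≤ suc x) (sym (proj₂ (ν-property k))) (subst (attach (ν k) ≤_) e2 o1)))
      ... | inj₂ (inj₁ (_ , e2 , _)) = ⊥-elim (<⇒≱ (≤-<-trans hx (lowest<top k)) (≤-reflexive (sym e2)))
      ... | inj₂ (inj₂ (refl , refl , _)) = ≤-antisym hx (lowest-least (ν k) x ed) , inj₂ (refl , refl)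

      leg≥n₀ : ∀ i → Valid (rayL i) → n₀ ≤ leg i
      leg≥n₀ i h = ≤-trans (proj₁ (ν-property 0))
        (subst (_≤ leg i) (cong proj₁ (spine-tri-pos 0)) (leg-mono (subst (_≤ i) (+-identityʳ (tri-pos 0)) h)))

      embed : Label → V G
      embed apexL = v
      embed (rayL i) = spineV i
      embed (triL k) = triV k
      embed (spokeL k j) = spokeV k j

      embed-inj : ∀ α β → Valid α → Valid β → embed α ≡ embed β → α ≡ β
      embed-inj apexL apexL _ _ _ = refl
      embed-inj apexL (rayL i) _ _ eq = ⊥-elim (C≢v _ _ (sym eq))
      embed-inj (rayL i) apexL _ _ eq = ⊥-elim (C≢v _ _ eq)
      embed-inj apexL (spokeL k j) _ _ eq = ⊥-elim (C≢v _ _ (sym eq))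
      embed-inj (spokeL k j) apexL _ _ eq = ⊥-elim (C≢v _ _ eq)
      embed-inj apexL (triL k) _ _ eq = ⊥-elim (C≢v _ _ (sym eq))
      embed-inj (triL k) apexL _ _ eq = ⊥-elim (C≢v _ _ eq)
      embed-inj (rayL i) (rayL i') _ _ eq = cong rayL (spineV-injective i i' eq)
      embed-inj (rayL i) (triL k) _ _ eq = ⊥-elim (spineV≢lower-leg i (lowest<attach k) eq)
      embed-inj (triL k) (rayL i) _ _ eq = ⊥-elim (spineV≢lower-leg i (lowest<attach k) (sym eq))
      embed-inj (rayL i) (spokeL k j) _ vb eq = ⊥-elim (spineV≢lower-leg i (spoke<attach k j vb) eq)
      embed-inj (spokeL k j) (rayL i) va _ eq = ⊥-elim (spineV≢lower-leg i (spoke<attach k j va) (sym eq))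
      embed-inj (triL k) (triL k') _ _ eq with lower-leg-injective (lowest<attach k) (lowest<attach k') eq
      ... | e1 , _ = cong triL (ν-injective {k} {k'} e1)
      embed-inj (triL k) (spokeL k' j) _ vb eq with lower-leg-injective (lowest<attach k) (spoke<attach k' j vb) eq
      ... | e1 , e2 with ν-injective {k} {k'} e1
      ... | refl = ⊥-elim (<-irrefl (sym e2) (spoke<lowest k j vb))
      embed-inj (spokeL k' j) (triL k) va _ eq with lower-leg-injective (lowest<attach k) (spoke<attach k' j va) (sym eq)
      ... | e1 , e2 with ν-injective {k} {k'} e1
      ... | refl = ⊥-elim (<-irrefl (sym e2) (spoke<lowest k j va))
      embed-inj (spokeL k j) (spokeL k' j') va vb eq with lower-leg-injective (spoke<attach k j va) (spoke<attach k' j' vb) eq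
      ... | e1 , e2 with ν-injective {k} {k'} e1
      ... | refl = cong (spokeL k) (+-cancelˡ-≡ (base k) _ _ e2)

      embed-adj : ∀ α β → α ∼ β → E G (embed α) (embed β)
      embed-adj _ _ (apex-spoke k _) = subst (λ z → E G v (C (ν k) z)) (sym (+-identityʳ (base k))) (Base.v∼base k)
      embed-adj _ _ (apex-tri k eq) =
        subst (λ z → E G v (C (ν k) z)) (≤-antisym (Base.base≤ k) (m∸n≡0⇒m≤n eq)) (Base.v∼base k)
      embed-adj _ _ (spoke-spoke k j h) = subst (λ z → E G (spokeV k j) (C (ν k) z)) (sym (+-suc (base k) j))
        (leg-edge (ν k) (base k + j) (subst (_≤ top (ν k)) (+-suc (base k) j)
          (<⇒≤ (<-trans (spoke<lowest k (suc j) h) (lowest<top k)))))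
      embed-adj _ _ (spoke-tri k j eq) = subst (λ z → E G (spokeV k j) (C (ν k) z)) next≡lowest
        (leg-edge (ν k) (base k + j) (subst (_≤ top (ν k)) (sym next≡lowest) (<⇒≤ (lowest<top k))))
        where next≡lowest : suc (base k + j) ≡ lowest (ν k)
              next≡lowest = trans (sym (+-suc (base k) j)) (trans (cong (base k +_) eq) (m+[n∸m]≡n (Base.base≤ k)))
      embed-adj _ _ (tri-ray₁ k) = subst (E G (triV k)) (sym (cong vertex (spine-tri-pos k)))
        (subst (λ z → E G (triV k) (C (ν k) z)) (proj₂ (ν-property k)) (leg-edge (ν k) (lowest (ν k)) (lowest<top k)))
      embed-adj _ _ (tri-ray₂ k) = subst (E G (triV k)) (sym (cong vertex (spine-tri-pos+1 k))) (E-sym G (lowest-edge (ν k)))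
      embed-adj _ _ (ray-ray i _) = spine-edge i

      v∼triV⇒spoke-len≡0 : ∀ k → E G v (triV k) → spoke-len k ≡ 0
      v∼triV⇒spoke-len≡0 k ed with m≤n⇒m<n∨m≡n (Base.base≤ k)
      ... | inj₂ eq = trans (cong (lowest (ν k) ∸_) eq) (n∸n≡0 (lowest (ν k)))
      ... | inj₁ lt = ⊥-elim (Base.¬v∼above-base k (lowest (ν k)) lt ≤-refl ed)

      spine-tri-edge : ∀ i k → E G (spineV i) (triV k) → triL k ∼ rayL i
      spine-tri-edge i k ed with tri-edge-unique k (leg i) (height i) (lowest (ν k)) (spine-OnSpine i) ≤-refl ed
      ... | _ , inj₁ (e1 , e2) with spine-injective {i} {tri-pos k} (trans (cong₂ _,_ e1 e2) (sym (spine-tri-pos k)))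
      ... | refl = tri-ray₁ k
      spine-tri-edge i k ed | _ , inj₂ (e1 , e2)
        with spine-injective {i} {suc (tri-pos k)} (trans (cong₂ _,_ e1 e2) (sym (spine-tri-pos+1 k)))
      ... | refl = tri-ray₂ k

      ¬spine-spoke-edge : ∀ i k j → j < spoke-len k → ¬ E G (spineV i) (spokeV k j)
      ¬spine-spoke-edge i k j h ed
        with tri-edge-unique k (leg i) (height i) (base k + j) (spine-OnSpine i) (<⇒≤ (spoke<lowest k j h)) ed
      ... | e1 , _ = <-irrefl e1 (spoke<lowest k j h)

      tri-spoke-edge : ∀ k k' j → j < spoke-len k' → E G (triV k) (spokeV k' j) → spokeL k' j ∼ triL k
      tri-spoke-edge k k' j h ed with lower-leg-edge (lowest<attach k) (spoke<attach k' j h) ed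
      ... | e1 , rel with ν-injective {k} {k'} e1
      ... | refl with rel
      ... | inj₁ e2 = ⊥-elim (<-asym (spoke<lowest k j h) (subst (lowest (ν k) <_) (sym e2) (n<1+n _)))
      ... | inj₂ e2 = spoke-tri k j (sym (trans (cong (_∸ base k) (sym (trans (+-suc (base k) j) (sym e2))))
                                                (m+n∸m≡n (base k) (suc j))))

      embed-reflect : ∀ α β → Valid α → Valid β → E G (embed α) (embed β) → α ∼ β ⊎ β ∼ α
      embed-reflect apexL apexL _ _ ed = ⊥-elim (E-irr G ed)
      embed-reflect apexL (rayL i) _ vb ed = ⊥-elim (¬v∼spine i (leg≥n₀ i vb) ed)
      embed-reflect (rayL i) apexL va _ ed = ⊥-elim (¬v∼spine i (leg≥n₀ i va) (E-sym G ed))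
      embed-reflect apexL (spokeL k j) _ vb ed with Base.v∼spoke⇒base k j (<⇒≤ (spoke<lowest k j vb)) ed
      ... | refl = inj₁ (apex-spoke k vb)
      embed-reflect (spokeL k j) apexL va _ ed with Base.v∼spoke⇒base k j (<⇒≤ (spoke<lowest k j va)) (E-sym G ed)
      ... | refl = inj₂ (apex-spoke k va)
      embed-reflect apexL (triL k) _ _ ed = inj₁ (apex-tri k (v∼triV⇒spoke-len≡0 k ed))
      embed-reflect (triL k) apexL _ _ ed = inj₂ (apex-tri k (v∼triV⇒spoke-len≡0 k (E-sym G ed)))
      embed-reflect (rayL i) (rayL i') va vb ed with spine-edge-cases i i' ed
      ... | inj₁ refl = inj₁ (ray-ray i va)
      ... | inj₂ refl = inj₂ (ray-ray i' vb)
      embed-reflect (rayL i) (triL k) _ _ ed = inj₂ (spine-tri-edge i k ed)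
      embed-reflect (triL k) (rayL i) _ _ ed = inj₁ (spine-tri-edge i k (E-sym G ed))
      embed-reflect (rayL i) (spokeL k j) _ vb ed = ⊥-elim (¬spine-spoke-edge i k j vb ed)
      embed-reflect (spokeL k j) (rayL i) va _ ed = ⊥-elim (¬spine-spoke-edge i k j va (E-sym G ed))
      embed-reflect (triL k) (triL k') _ _ ed with lower-leg-edge (lowest<attach k) (lowest<attach k') ed
      ... | e1 , rel with ν-injective {k} {k'} e1
      ... | refl with rel
      ... | inj₁ e2 = ⊥-elim (<-irrefl e2 (n<1+n (lowest (ν k))))
      ... | inj₂ e2 = ⊥-elim (<-irrefl e2 (n<1+n (lowest (ν k))))
      embed-reflect (triL k) (spokeL k' j) _ vb ed = inj₂ (tri-spoke-edge k k' j vb ed)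
      embed-reflect (spokeL k' j) (triL k) va _ ed = inj₁ (tri-spoke-edge k k' j va (E-sym G ed))
      embed-reflect (spokeL k j) (spokeL k' j') va vb ed
        with lower-leg-edge (spoke<attach k j va) (spoke<attach k' j' vb) ed
      ... | e1 , rel with ν-injective {k} {k'} e1
      ... | refl with rel
      ... | inj₁ e2 with +-cancelˡ-≡ (base k) j' (suc j) (trans e2 (sym (+-suc (base k) j)))
      ... | refl = inj₁ (spoke-spoke k j vb)
      embed-reflect (spokeL k j) (spokeL k' j') va vb ed | e1 , rel | refl | inj₂ e2
        with +-cancelˡ-≡ (base k) j (suc j') (trans e2 (sym (+-suc (base k) j')))
      ... | refl = inj₂ (spoke-spoke k j' va)

      conclusion : Conclusion G
      conclusion = inj₂ (σ , allowed , induced-copy G embed embed-inj embed-adj embed-reflect)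

    conclusion : Conclusion G
    conclusion with unbounded-or-eventually-not em (λ n → n₀ ≤ n × Triangle n)
    ... | inj₁ triangles = Triangles.conclusion triangles
    ... | inj₂ (M , no-triangle) = NoTriangles.conclusion M no-triangle

  conclusion : Conclusion G
  conclusion with unbounded-or-eventually-not em v∼spine
  ... | inj₁ unbounded = ManySpineNeighbours.conclusion unbounded
  ... | inj₂ (N , ¬v∼spine-from) = FewSpineNeighbours.conclusion N ¬v∼spine-from

comb⇒conclusion : ∀ {G v} → ExcludedMiddle 0ℓ → Comb G v → Conclusion G
comb⇒conclusion em K = CombAnalysis.conclusion em K

-- Connecting trees

module ConnectingTree {G : Graph} (em : ExcludedMiddle 0ℓ) {v : V G} {𝒱 : V G → Set} (T : VConnTree G v 𝒱) where
  open VConnTree T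

  L : ℕ → ℕ
  L k = len (P k)

  Q : ℕ → ℕ → V G
  Q k = P k !_

  InTree : ℕ → V G → Set
  InTree = InTreeUpTo v 𝒱 P

  InTree≢v : ∀ {k x} → InTree k x → x ≢ v
  InTree≢v (i , _ , j , eq) = subst (_≢ v) eq (P-inH i j)

  Used-mono : ∀ {k k' x} → k ≤ k' → Used v 𝒱 P k x → Used v 𝒱 P k' x
  Used-mono le (i , lt , eq) = i , <-≤-trans lt le , eq

  module FirstPath (x : V G) = Search (λ i → OnPath (P i) x) (λ _ → em)

  grade-exists : ∀ k u → InTree k u → Σ ℕ λ i → Σ ℕ λ d → GradePos v 𝒱 P k u i d
  grade-exists k u (i₀ , i₀<k , on) with FirstPath.least u i₀ on | FirstPath.least≤ u i₀ on
  ... | i , (j , eq) , first | i≤i₀ = i , len (P i) ∸ toℕ j , ≤-<-trans i≤i₀ i₀<k , first , j , eq , refl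

  module Minimal (k' : ℕ) where

    k : ℕ
    k = suc k'

    candidate : Candidate v 𝒱 P k (P k)
    candidate = proj₁ (step k (s≤s z≤n))

    parent : ℕ
    parent = proj₁ (proj₂ (step k (s≤s z≤n)))

    parent-dist : ℕ
    parent-dist = proj₁ (proj₂ (proj₂ (step k (s≤s z≤n))))

    grade : GradePos v 𝒱 P k (last {G} (P k)) parent parent-dist
    grade = proj₁ (proj₂ (proj₂ (proj₂ (step k (s≤s z≤n)))))

    grade-minimal : ∀ R i d → Candidate v 𝒱 P k R → GradePos v 𝒱 P k (last {G} R) i d →
                    (L k , parent , parent-dist) ≤lex (len R , i , d)
    grade-minimal = proj₂ (proj₂ (proj₂ (proj₂ (step k (s≤s z≤n)))))

    len-minimal : ∀ R → Candidate v 𝒱 P k R → L k ≤ len R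
    len-minimal R c with grade-exists k (last {G} R) (proj₂ (proj₂ (proj₂ c)))
    ... | i , d , gp with grade-minimal R i d c gp
    ... | inj₁ lt = <⇒≤ lt
    ... | inj₂ (eq , _) = ≤-reflexive eq

    first∈𝒱 : 𝒱 (Q k 0)
    first∈𝒱 = proj₁ (proj₂ candidate)

    first-unused : ¬ Used v 𝒱 P k (Q k 0)
    first-unused = proj₁ (proj₂ (proj₂ candidate))

    last-in-tree : InTree k (Q k (L k))
    last-in-tree = subst (InTree k) (last≡! (P k)) (proj₂ (proj₂ (proj₂ candidate)))

    rerouted-candidate : ∀ R → PathIn (_≢ v) R → first {G} R ≡ Q k 0 → InTree k (last {G} R) → Candidate v 𝒱 P k R
    rerouted-candidate R ≢v eq in-tree =
      ≢v , subst 𝒱 (sym eq) first∈𝒱 , subst (λ z → ¬ Used v 𝒱 P k z) (sym eq) first-unused , in-tree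

    open PathSurgery (P k)

    inner-not-in-tree : ∀ j → j < L k → ¬ InTree k (Q k j)
    inner-not-in-tree j j<L in-tree = <⇒≱ j<L (len-minimal (prefix j (<⇒≤ j<L))
      (rerouted-candidate (prefix j (<⇒≤ j<L)) (prefix-PathIn {S = _≢ v} j (<⇒≤ j<L) (P-inH k)) refl (subst (InTree k) (sym (prefix-last j (<⇒≤ j<L))) in-tree)))

    module EdgeToTree (j : ℕ) (y : V G) (j<L : j < L k) (y-in : InTree k y) (edge : E G (Q k j) y) where
      open PrefixThen j y (<⇒≤ j<L) (λ i i≤j eq → inner-not-in-tree i (≤-<-trans i≤j j<L) (subst (InTree k) (sym eq) y-in)) edge

      path-candidate : Candidate v 𝒱 P k path
      path-candidate = rerouted-candidate path (path-PathIn {S = _≢ v} (P-inH k) (InTree≢v y-in)) (f-≤ z≤n)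
                                          (subst (InTree k) (sym path-last) y-in)

      penultimate : suc j ≡ L k
      penultimate = ≤-antisym j<L (len-minimal path path-candidate)

      grade-≥ : ∀ i d → GradePos v 𝒱 P k y i d → parent < i ⊎ (parent ≡ i × parent-dist ≤ d)
      grade-≥ i d gp with grade-minimal path i d path-candidate (subst (λ z → GradePos v 𝒱 P k z i d) (sym path-last) gp)
      ... | inj₁ lt = ⊥-elim (<-irrefl (sym penultimate) lt)
      ... | inj₂ (_ , ge) = ge

    no-chord : ∀ j j' → suc j < j' → j' < L k → ¬ E G (Q k j) (Q k j')
    no-chord j j' j+1<j' j'<L chord = <⇒≱ path-shorter (len-minimal path
      (rerouted-candidate path (path-PathIn {S = _≢ v} (P-inH k)) (f-≤ z≤n) (subst (InTree k) (sym path-last) last-in-tree)))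
      where open Shortcut j j' j+1<j' (<⇒≤ j'<L) chord

  𝒱-on-path⇒Used : ∀ i {x} → 𝒱 x → OnPath (P i) x → Used v 𝒱 P (suc i) x
  𝒱-on-path⇒Used = <-rec _ go
    where
      go : ∀ i → (∀ {i'} → i' < i → ∀ {x} → 𝒱 x → OnPath (P i') x → Used v 𝒱 P (suc i') x) →
           ∀ {x} → 𝒱 x → OnPath (P i) x → Used v 𝒱 P (suc i) x
      go i rec x∈𝒱 on with OnPath⇒! (P i) on
      ... | zero , _ , eq = i , ≤-refl , eq
      go zero rec x∈𝒱 on | suc m , h , eq = ⊥-elim (<⇒≱ (s≤s z≤n) (subst (suc m ≤_) (proj₁ base) h))
      go (suc i) rec {x} x∈𝒱 on | suc m , h , eq with em {Used v 𝒱 P (suc i) x}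
      ... | yes used = Used-mono (n≤1+n _) used
      ... | no unused with m≤n⇒m<n∨m≡n h
      ... | inj₂ at-last with Minimal.last-in-tree i
      ... | i' , i'<1+i , on' =
        Used-mono (≤-trans i'<1+i (n≤1+n _))
          (rec i'<1+i x∈𝒱 (subst (OnPath (P i')) (trans (cong (Q (suc i)) (sym at-last)) eq) on'))
      go (suc i) rec {x} x∈𝒱 on | suc m , h , eq | no unused | inj₁ inner =
        ⊥-elim (<⇒≱ shorter (Minimal.len-minimal i (suffix (suc m) h) candidate))
        where
          open PathSurgery (P (suc i))
          shorter : L (suc i) ∸ suc m < L (suc i)
          shorter = ∸-monoʳ-< {L (suc i)} {suc m} {0} (s≤s z≤n) h
          first≡x : first {G} (suffix (suc m) h) ≡ x
          first≡x = trans (cong (Q (suc i)) (+-identityʳ (suc m))) eq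
          candidate : Candidate v 𝒱 P (suc i) (suffix (suc m) h)
          candidate = suffix-PathIn {S = _≢ v} (suc m) h (P-inH (suc i)) , subst 𝒱 (sym first≡x) x∈𝒱 ,
                      subst (λ z → ¬ Used v 𝒱 P (suc i) z) (sym first≡x) unused ,
                      subst (InTree (suc i)) (sym (suffix-last (suc m) h)) (Minimal.last-in-tree i)

  len≥1 : ∀ k' → 1 ≤ L (suc k')
  len≥1 k' with L (suc k') in eq
  ... | suc _ = s≤s z≤n
  ... | zero with Minimal.last-in-tree k'
  ... | i , i<k , on = ⊥-elim (Minimal.first-unused k'
          (Used-mono i<k (𝒱-on-path⇒Used i (Minimal.first∈𝒱 k') (subst (OnPath (P i)) (cong (Q (suc k')) eq) on))))

  FirstOn : ℕ → V G → Set
  FirstOn k x = OnPath (P k) x × (∀ i → i < k → ¬ OnPath (P i) x)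

  FirstOn-unique : ∀ {k k' x} → FirstOn k x → FirstOn k' x → k ≡ k'
  FirstOn-unique {k} {k'} (on , first) (on' , first') with <-cmp k k'
  ... | tri< lt _ _ = ⊥-elim (first' k lt on)
  ... | tri≈ _ eq _ = eq
  ... | tri> _ _ gt = ⊥-elim (first k' gt on')

  inner-FirstOn : ∀ k' j → j < L (suc k') → FirstOn (suc k') (Q (suc k') j)
  inner-FirstOn k' j h = !-OnPath (P (suc k')) j , λ i lt on → Minimal.inner-not-in-tree k' j h (i , lt , on)

  owner : V G → ℕ
  owner y with em {Σ ℕ λ k → OnPath (P k) y}
  ... | yes (k , on) = proj₁ (FirstPath.least y k on)
  ... | no _ = 0

  owner-FirstOn : ∀ {k y} → FirstOn k y → owner y ≡ k
  owner-FirstOn {k} {y} o with em {Σ ℕ λ k → OnPath (P k) y}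
  ... | yes (k₀ , on) = FirstOn-unique (proj₂ (FirstPath.least y k₀ on)) o
  ... | no ¬on = ⊥-elim (¬on (k , proj₁ o))

  parent : ℕ → ℕ
  parent zero = zero
  parent (suc k') = Minimal.parent k'

  parent< : ∀ k' → parent (suc k') < suc k'
  parent< k' = proj₁ (Minimal.grade k')

  attach-pos : ℕ → ℕ
  attach-pos k' = toℕ (proj₁ (proj₂ (proj₂ (Minimal.grade k'))))

  attach-pos-last : ∀ k' → Q (parent (suc k')) (attach-pos k') ≡ Q (suc k') (L (suc k'))
  attach-pos-last k' = trans (sym (at≡! (P (parent (suc k'))) _))
    (trans (proj₁ (proj₂ (proj₂ (proj₂ (Minimal.grade k'))))) (last≡! (P (suc k'))))

  attach-pos≤len : ∀ k' → attach-pos k' ≤ L (parent (suc k'))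
  attach-pos≤len k' = toℕ≤pred[n] (proj₁ (proj₂ (proj₂ (Minimal.grade k'))))

  parent-dist≡ : ∀ k' → Minimal.parent-dist k' ≡ L (parent (suc k')) ∸ attach-pos k'
  parent-dist≡ k' = proj₂ (proj₂ (proj₂ (proj₂ (Minimal.grade k'))))

  last-FirstOn-parent : ∀ k' → FirstOn (parent (suc k')) (Q (suc k') (L (suc k')))
  last-FirstOn-parent k' =
    (proj₁ (proj₂ (proj₂ (Minimal.grade k'))) , trans (proj₁ (proj₂ (proj₂ (proj₂ (Minimal.grade k'))))) (last≡! (P (suc k')))) ,
    subst (λ z → ∀ i → i < parent (suc k') → ¬ OnPath (P i) z) (last≡! (P (suc k'))) (proj₁ (proj₂ (Minimal.grade k')))

  module König (locally-finite : VConnTree.LocallyFinite T) where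

    neighbours : ℕ → ℕ → List (V G)
    neighbours i m = proj₁ (locally-finite (Q i m) (i , clamp (L i) m , refl))

    neighbours-complete : ∀ i m y → VConnTree.TE T (Q i m) y → y ∈ neighbours i m
    neighbours-complete i m = proj₂ (locally-finite (Q i m) (i , clamp (L i) m , refl))

    -- The penultimate vertex of a child P (suc c) of P i is a T-neighbour of P i owned by suc c.
    child-bound : ℕ → ℕ
    child-bound i = sumUpTo (L i) (λ m → sum (map owner (neighbours i m)))

    child≤child-bound : ∀ c → suc c ≤ child-bound (parent (suc c))
    child≤child-bound c = subst (_≤ child-bound i) (owner-FirstOn (inner-FirstOn c (pred (L (suc c))) pred<))
      (≤-trans (∈⇒≤sum owner (neighbours-complete i (attach-pos c) _ tree-edge))
               (≤sumUpTo (λ m → sum (map owner (neighbours i m))) (attach-pos≤len c)))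
      where
        i = parent (suc c)
        pred-suc : suc (pred (L (suc c))) ≡ L (suc c)
        pred-suc = suc-pred-≥1 (len≥1 c)
        pred< : pred (L (suc c)) < L (suc c)
        pred< = subst (pred (L (suc c)) <_) pred-suc ≤-refl
        j : Fin (L (suc c))
        j = fromℕ< pred<
        tree-edge : VConnTree.TE T (Q i (attach-pos c)) (Q (suc c) (pred (L (suc c))))
        tree-edge = suc c , j , inj₂
          ( trans (at≡! (P (suc c)) _) (cong (Q (suc c)) (trans (toℕ-inject₁ j) (toℕ-fromℕ< pred<)))
          , trans (at≡! (P (suc c)) _) (trans (cong (Q (suc c)) (trans (cong suc (toℕ-fromℕ< pred<)) pred-suc))
                                              (sym (attach-pos-last c))))

    ancestor : ℕ → ℕ → ℕ
    ancestor zero d = d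
    ancestor (suc m) d = parent (ancestor m d)

    ancestor-parent : ∀ m d → ancestor m (parent d) ≡ parent (ancestor m d)
    ancestor-parent zero d = refl
    ancestor-parent (suc m) d = cong parent (ancestor-parent m d)

    Descendant : ℕ → ℕ → Set
    Descendant i d = Σ ℕ λ m → ancestor m d ≡ i

    descends-from-root : ∀ d → Descendant 0 d
    descends-from-root = <-rec _ go
      where
        go : ∀ d → (∀ {d'} → d' < d → Descendant 0 d') → Descendant 0 d
        go zero rec = 0 , refl
        go (suc d) rec with rec (parent< d)
        ... | m , eq = suc m , trans (sym (ancestor-parent m (suc d))) eq

    descendant-child : ∀ m i d → ancestor m d ≡ i → d ≢ i → Σ ℕ λ c → parent (suc c) ≡ i × Descendant (suc c) d
    descendant-child zero i d eq d≢i = ⊥-elim (d≢i eq)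
    descendant-child (suc m) i d eq d≢i with ancestor m d in eq₀
    ... | zero = descendant-child m i d (trans eq₀ eq) d≢i
    ... | suc c = c , eq , m , eq₀

    -- Finitely many children, each with boundedly many descendants, leave only boundedly many.
    module FiniteBranching (i : ℕ) (few : ∀ c → parent (suc c) ≡ i → ¬ Unbounded (Descendant (suc c))) where

      bound : ℕ → ℕ
      bound c with unbounded-or-eventually-not em (Descendant c)
      ... | inj₁ _ = 0
      ... | inj₂ (N , _) = N

      bound-spec : ∀ c → parent (suc c) ≡ i → ∀ d → bound (suc c) ≤ d → ¬ Descendant (suc c) d
      bound-spec c child with unbounded-or-eventually-not em (Descendant (suc c))
      ... | inj₁ many = ⊥-elim (few c child many)
      ... | inj₂ (_ , none) = none

      ¬many : ¬ Unbounded (Descendant i)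
      ¬many many with many (suc i + sumUpTo (child-bound i) bound)
      ... | d , le , m , eq with descendant-child m i d eq (λ d≡i → <⇒≱ (≤-trans (m≤m+n (suc i) _) le) (≤-reflexive d≡i))
      ... | c , child , desc = bound-spec c child d
            (≤-trans (≤sumUpTo bound (subst (λ z → suc c ≤ child-bound z) child (child≤child-bound c)))
                     (≤-trans (m≤n+m _ (suc i)) le)) desc

    opaque
      many-descendants-child : ∀ i → Unbounded (Descendant i) →
                               Σ ℕ λ c → parent (suc c) ≡ i × Unbounded (Descendant (suc c))
      many-descendants-child i many with em {Σ ℕ λ c → parent (suc c) ≡ i × Unbounded (Descendant (suc c))}
      ... | yes child = child
      ... | no ¬child = ⊥-elim (FiniteBranching.¬many i (λ c ch m → ¬child (c , ch , m)) many)

    branch : ℕ → Σ ℕ λ c → Unbounded (Descendant (suc c))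
    branch zero = proj₁ child , proj₂ (proj₂ child)
      where child = many-descendants-child 0 (λ N → N , ≤-refl , descends-from-root N)
    branch (suc n) = proj₁ child , proj₂ (proj₂ child)
      where child = many-descendants-child (suc (proj₁ (branch n))) (proj₂ (branch n))

    κ : ℕ → ℕ
    κ n = proj₁ (branch n)

    κ-parent : ∀ n → parent (suc (κ (suc n))) ≡ suc (κ n)
    κ-parent n = proj₁ (proj₂ (many-descendants-child (suc (κ n)) (proj₂ (branch n))))

  module CombOfBranch (κ : ℕ → ℕ) (κ-parent : ∀ n → parent (suc (κ (suc n))) ≡ suc (κ n))
                      (𝒱⊆N : ∀ x → 𝒱 x → E G v x) where

    K : ℕ → ℕ
    K n = suc (κ n)

    K-inc : ∀ n → K n < K (suc n)
    K-inc n = subst (_< K (suc n)) (κ-parent n) (parent< (κ (suc n)))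

    open StrictlyIncreasing K K-inc

    top : ℕ → ℕ
    top n = pred (L (K n))

    attach : ℕ → ℕ
    attach n = attach-pos (κ (suc n))

    C : ℕ → ℕ → V G
    C n j = Q (K n) j

    L-pred : ∀ n → suc (top n) ≡ L (K n)
    L-pred n = suc-pred-≥1 (len≥1 (κ n))

    ≤top⇒<L : ∀ n {j} → j ≤ top n → j < L (K n)
    ≤top⇒<L n {j} h = subst (j <_) (L-pred n) (s≤s h)

    <L⇒≤top : ∀ n {j} → j < L (K n) → j ≤ top n
    <L⇒≤top n {j} h = ≤-pred (subst (j <_) (sym (L-pred n)) h)

    attach-last : ∀ n → C n (attach n) ≡ Q (K (suc n)) (L (K (suc n)))
    attach-last n = subst (λ z → Q z (attach n) ≡ Q (K (suc n)) (L (K (suc n)))) (κ-parent n) (attach-pos-last (κ (suc n)))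

    attach-FirstOn : ∀ n → FirstOn (K n) (Q (K (suc n)) (L (K (suc n))))
    attach-FirstOn n = subst (λ z → FirstOn z (Q (K (suc n)) (L (K (suc n))))) (κ-parent n) (last-FirstOn-parent (κ (suc n)))

    attach<L : ∀ n → attach n < L (K n)
    attach<L n with m≤n⇒m<n∨m≡n (subst (λ z → attach n ≤ L z) (κ-parent n) (attach-pos≤len (κ (suc n))))
    ... | inj₁ lt = lt
    ... | inj₂ eq with Minimal.last-in-tree (κ n)
    ... | i , lt , on = ⊥-elim (proj₂ (attach-FirstOn n) i lt
                          (subst (OnPath (P i)) (trans (cong (Q (K n)) (sym eq)) (attach-last n)) on))

    C-FirstOn : ∀ n j → j ≤ top n → FirstOn (K n) (C n j)
    C-FirstOn n j h = inner-FirstOn (κ n) j (≤top⇒<L n h)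

    C-injective : ∀ {n j n' j'} → j ≤ top n → j' ≤ top n' → C n j ≡ C n' j' → n ≡ n' × j ≡ j'
    C-injective {n} {j} {n'} {j'} h h' eq
      with injective {n} {n'} (FirstOn-unique (C-FirstOn n j h) (subst (FirstOn (K n')) (sym eq) (C-FirstOn n' j' h')))
    ... | refl = refl , !-injective (P (K n)) (<⇒≤ (≤top⇒<L n h)) (<⇒≤ (≤top⇒<L n h')) eq

    attach-edge : ∀ n → E G (C (suc n) (top (suc n))) (C n (attach n))
    attach-edge n = subst (E G (C (suc n) (top (suc n)))) (trans (cong (Q (K (suc n))) (L-pred (suc n))) (sym (attach-last n)))
                      (!-adjacent (P (K (suc n))) (top (suc n)) (≤-reflexive (L-pred (suc n))))

    C-grade : ∀ n j n' → j < L (K n) → n < n' → GradePos v 𝒱 P (K n') (C n j) (K n) (L (K n) ∸ j)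
    C-grade n j n' h lt = mono-< lt , proj₂ (C-FirstOn n j (<L⇒≤top n h)) , clamp (L (K n)) j , refl ,
                          cong (L (K n) ∸_) (sym (toℕ-clamp _ j (<⇒≤ h)))

    -- An edge from leg n' down to an earlier leg n leaves from the top of leg n' (minimal length)
    -- and lands in the parent leg at or below the attachment point (minimal grade).
    edge-to-earlier-leg : ∀ {n j n' j'} → j ≤ top n → j' ≤ top n' → n < n' → E G (C n' j') (C n j) →
                          n' ≡ suc n × j' ≡ top n' × j ≤ attach n
    edge-to-earlier-leg {n} {j} {suc m} {j'} h h' (s≤s n≤m) ed
      with EdgeToTree.penultimate (κ (suc m)) j' (C n j) (≤top⇒<L (suc m) h') in-tree ed
         | EdgeToTree.grade-≥ (κ (suc m)) j' (C n j) (≤top⇒<L (suc m) h') in-tree ed (K n) (L (K n) ∸ j)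
                                (C-grade n j (suc m) (≤top⇒<L n h) (s≤s n≤m))
      where
        open Minimal
        in-tree : InTree (K (suc m)) (C n j)
        in-tree = K n , mono-< (s≤s n≤m) , clamp (L (K n)) j , refl
    ... | _ | inj₁ gt = ⊥-elim (<⇒≱ (subst (_< K n) (κ-parent m) gt) (mono-≤ n≤m))
    ... | top≡ | inj₂ (eq , dist≤) with injective {m} {n} (trans (sym (κ-parent m)) eq)
    ... | refl = refl , cong pred top≡ , ∸-cancelʳ-≤ (<⇒≤ (≤top⇒<L n h))
          (subst (_≤ L (K n) ∸ j) (trans (parent-dist≡ (κ (suc n))) (cong (λ z → L z ∸ attach n) (κ-parent n))) dist≤)
      where open Minimal

    edge-cases : ∀ {n j n' j'} → j ≤ top n → j' ≤ top n' → E G (C n j) (C n' j') →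
                 (n ≡ n' × (j' ≡ suc j ⊎ j ≡ suc j'))
                 ⊎ (n' ≡ suc n × j' ≡ top n' × j ≤ attach n)
                 ⊎ (n ≡ suc n' × j ≡ top n × j' ≤ attach n')
    edge-cases {n} {j} {n'} {j'} h h' ed with <-cmp n n'
    ... | tri< lt _ _ = inj₂ (inj₁ (edge-to-earlier-leg h h' lt (E-sym G ed)))
    ... | tri> _ _ gt = inj₂ (inj₂ (edge-to-earlier-leg h' h gt ed))
    ... | tri≈ _ refl _ with <-cmp j j'
    ... | tri≈ _ refl _ = ⊥-elim (E-irr G ed)
    ... | tri< lt _ _ with m≤n⇒m<n∨m≡n lt
    ... | inj₂ eq = inj₁ (refl , inj₁ (sym eq))
    ... | inj₁ lt' = ⊥-elim (Minimal.no-chord (κ n) j j' lt' (≤top⇒<L n h') ed)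
    edge-cases {n} {j} {n'} {j'} h h' ed | tri≈ _ refl _ | tri> _ _ gt with m≤n⇒m<n∨m≡n gt
    ... | inj₂ eq = inj₁ (refl , inj₂ (sym eq))
    ... | inj₁ lt' = ⊥-elim (Minimal.no-chord (κ n) j' j lt' (≤top⇒<L n h) (E-sym G ed))

    comb : Comb G v
    comb = record
      { top = top ; attach = attach ; attach≤top = λ n → <L⇒≤top n (attach<L n) ; C = C
      ; C-injective = C-injective ; C≢v = λ n j → P-inH (K n) _
      ; leg-edge = λ n j h → !-adjacent (P (K n)) j (<⇒≤ (≤top⇒<L n h)) ; attach-edge = attach-edge
      ; edge-cases = edge-cases ; v-foot = λ n → 𝒱⊆N _ (Minimal.first∈𝒱 (κ n)) }

lemma2p5 : ExcludedMiddle 0ℓ →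
    (G : Graph) (v : V G) (𝒱 : V G → Set) →
    InfiniteGraph G → TwoConnected G → InfiniteDegree G v →
    ¬ HasInducedKInf G →
    InfIndepNbhd G v 𝒱 →
    (T : VConnTree G v 𝒱) →
    VConnTree.LocallyFinite T →
    Σ (F∞E → ℕ) (λ σ → InducedCopy G F∞ σ)
    ⊎ Σ (FΔE → ℕ) (λ σ → AllowedΔ σ × InducedCopy G FΔ σ)
-- Only 𝒱 ⊆ N(v), the grade-minimality of T and local finiteness are needed.
lemma2p5 em G v 𝒱 _ _ _ _ (𝒱⊆N , _ , _) T locally-finite = comb⇒conclusion em comb
  where
    open ConnectingTree em T
    open König locally-finite using (κ; κ-parent)
    open CombOfBranch κ κ-parent 𝒱⊆N using (comb)
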